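{- Let $T\in\mathsf{HTrc}_{\mathcal L}$, let $\varphi$ be a closed Hyper-maxHML formula such that the decentralized monitor $\mathcal D_\emptyset(\varphi)$ is defined, and let $\mathcal R$ be a weak bisimulation with $(\mathcal D_\emptyset(\varphi),\mathcal M_\emptyset(\varphi))\in\mathcal R$. If $\mathcal D_\emptyset(\varphi)\triangleright T\rightarrowtail^*\mathsf{no}$, then $T\notin[\![\varphi]\!]$; if $\mathcal D_\emptyset(\varphi)\triangleright T\rightarrowtail^*\mathsf{yes}$, then $T\in[\![\varphi]\!]$.
   Context: Here $\mathcal D$ is an arbitrary decentralized synthesis function: a partial function assigning to pairs $(\sigma,\varphi)$ (a formula and a partial map from location variables to locations) a decentralized monitor $\mathcal D_\sigma(\varphi)$. Model. Fix a finite set $\mathsf{Act}$ of actions with $|\mathsf{Act}|\ge 2$ and a finite non-empty set $\mathcal L$ of locations. $\mathsf{Trc}=\mathsf{Act}^\omega$; a hypertrace is $T:\mathcal L\to\mathsf{Trc}$, $\mathsf{HTrc}_{\mathcal L}$ is the set of hypertraces; for $A:\mathcal L\to\mathsf{Act}$, $T\xrightarrow{A}T'$ iff $T(\ell)=A(\ell)\,T'(\ell)$ for all $\ell$; each $T$ has a unique such $(A,T')$, written $(hd(T),tl(T))$. Logic. Let $\Pi$ (location variables $\pi$) and $V$ (recursion variables $x$) be disjoint countably infinite sets. Formulas: $\varphi::=\mathsf{tt}\mid\mathsf{ff}\mid\varphi\wedge\varphi\mid\varphi\vee\varphi\mid\max x.\varphi\mid\min x.\varphi\mid x\mid\exists\pi.\varphi\mid\forall\pi.\varphi\mid\pi=\pi\mid\pi\neq\pi\mid[a_\pi]\varphi\mid\langle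 a_\pi\rangle\varphi$ ($a\in\mathsf{Act}$), guarded, with pairwise distinct bound location variables distinct from free ones; closed means no free location or recursion variables; Hyper-maxHML = formulas without $\min$. Semantics $[\![\varphi]\!]^\rho_\sigma$ ($\rho:V\rightharpoonup 2^{\mathsf{HTrc}_{\mathcal L}}$, $\sigma:\Pi\rightharpoonup\mathcal L$): $\mathsf{tt}\mapsto\mathsf{HTrc}_{\mathcal L}$, $\mathsf{ff}\mapsto\emptyset$, $x\mapsto\rho(x)$, $\wedge/\vee$ intersection/union, $\max x.\psi\mapsto\bigcup\{S\mid S\subseteq[\![\psi]\!]^{\rho[x\mapsto S]}_\sigma\}$, $\min x.\psi\mapsto\bigcap\{S\mid S\supseteq[\![\psi]\!]^{\rho[x\mapsto S]}_\sigma\}$, $\exists\pi.\psi\mapsto\bigcup_{\ell}[\![\psi]\!]^\rho_{\sigma[\pi\mapsto\ell]}$, $\forall\pi.\psi\mapsto\bigcap_\ell[\![\psi]\!]^\rho_{\sigma[\pi\mapsto\ell]}$, $\pi=\pi'\mapsto\mathsf{HTrc}_{\mathcal L}$ if $\sigma(\pi)=\sigma(\pi')$ else $\emptyset$ (dually for $\neq$), $[a_\pi]\psi\mapsto\{T\mid hd(T)(\sigma(\pi))=a\Rightarrow tl(T)\in[\![\psi]\!]^\rho_\sigma\}$, $\langle a_\pi\rangle\psi\mapsto\{T\mid hd(T)(\sigma(\pi))=a\wedge tl(T)\in[\![\psi]\!]^\rho_\sigma\}$; $[\![\varphi]\!]=[\![\varphi]\!]^\emptyset_\emptyset$ for closed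 $\varphi$. Centralized monitors: $m::=\mathsf{yes}\mid\mathsf{no}\mid\mathsf{end}\mid a_\ell.m\mid m+m\mid m\oplus m\mid m\otimes m\mid\mathsf{rec}\,x.m\mid x$; verdicts $v\in\{\mathsf{yes},\mathsf{no},\mathsf{end}\}$; $\odot\in\{\otimes,\oplus\}$. Transitions $m\xrightarrow{A}m'$ (least relation): $v\xrightarrow{A}v$; $a_\ell.m\xrightarrow{A}m$ if $A(\ell)=a$; $a_\ell.m\xrightarrow{A}\mathsf{end}$ if $A(\ell)\neq a$; $\mathsf{rec}\,x.m\xrightarrow{A}m'$ if $m\{\mathsf{rec}\,x.m/x\}\xrightarrow{A}m'$; $m+n\xrightarrow{A}m'$ if $m\xrightarrow{A}m'$, $m+n\xrightarrow{A}n'$ if $n\xrightarrow{A}n'$; $m\odot n\xrightarrow{A}m'\odot n'$ if $m\xrightarrow{A}m'$ and $n\xrightarrow{A}n'$. Verdict evaluation $m\Rrightarrow v$: least relation closed under (each also with operands of $+,\otimes,\oplus$ swapped) $v\Rrightarrow v$; $m\odot n\Rrightarrow\mathsf{end}$ if both $\Rrightarrow\mathsf{end}$; $m\oplus n\Rrightarrow\mathsf{yes}$ if $m\Rrightarrow\mathsf{yes}$; $m\otimes n\Rrightarrow\mathsf{no}$ if $m\Rrightarrow\mathsf{no}$; $m+n\Rrightarrow v$ if $m\Rrightarrow v$; $m\oplus n\Rrightarrow v$ if $m\Rrightarrow\mathsf{no}$ and $n\Rrightarrow v$; $m\otimes n\Rrightarrow v$ if $m\Rrightarrow\mathsf{yes}$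 and $n\Rrightarrow v$; $\mathsf{rec}\,x.m\Rrightarrow v$ if $m\{\mathsf{rec}\,x.m/x\}\Rrightarrow v$. Centralized instrumentation: $m\triangleright T\rightarrowtail m'\triangleright T'$ if $m\xrightarrow{A}m'$, $T\xrightarrow{A}T'$; $m\triangleright T\rightarrowtail v$ if $m\Rrightarrow v$. Centralized synthesis ($\varphi$ Hyper-maxHML, $\sigma$ defined on its free location variables): $\mathcal M_\sigma(\mathsf{tt})=\mathsf{yes}$, $\mathcal M_\sigma(\mathsf{ff})=\mathsf{no}$, $\mathcal M_\sigma(x)=x$, $\mathcal M_\sigma(\max x.\varphi)=\mathsf{rec}\,x.\mathcal M_\sigma(\varphi)$, $\wedge\mapsto\otimes$, $\vee\mapsto\oplus$, $\mathcal M_\sigma(\forall\pi.\varphi)=\bigotimes_{\ell\in\mathcal L}\mathcal M_{\sigma[\pi\mapsto\ell]}(\varphi)$, $\mathcal M_\sigma(\exists\pi.\varphi)=\bigoplus_{\ell\in\mathcal L}\mathcal M_{\sigma[\pi\mapsto\ell]}(\varphi)$, $\mathcal M_\sigma(\pi=\pi')=\mathsf{yes}$ if $\sigma(\pi)=\sigma(\pi')$ else $\mathsf{no}$, $\mathcal M_\sigma(\pi\neq\pi')=\mathsf{yes}$ if $\sigma(\pi)\neq\sigma(\pi')$ else $\mathsf{no}$, $\mathcal M_\sigma([a_\pi]\varphi)=a_{\sigma(\pi)}.\mathcal M_\sigma(\varphi)+\sum_{b\neq a}b_{\sigma(\pi)}.\mathsf{yes}$, $\mathcal M_\sigma(\langle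 a_\pi\rangle\varphi)=a_{\sigma(\pi)}.\mathcal M_\sigma(\varphi)+\sum_{b\neq a}b_{\sigma(\pi)}.\mathsf{no}$. Decentralized monitors. Let $\mathsf{Con}\supseteq\mathsf{Act}$ be a finite set of communication constants; communication actions are $(!G,\gamma)$ and $(?G,\gamma)$ with $G\subseteq\mathcal L$, $\gamma\in\mathsf{Con}$. $M::=[m]_\ell\mid M\vee M\mid M\wedge M$; local monitors $m::=\mathsf{yes}\mid\mathsf{no}\mid\mathsf{end}\mid a.m\mid c.m\mid m+m\mid m\oplus m\mid m\otimes m\mid\mathsf{rec}\,x.m\mid x$. Local transitions, labels $\lambda\in\mathsf{Act}\cup\{(!G,\gamma)\}\cup\{(?\ell,\gamma)\}$ (also with operands of $+,\otimes,\oplus$ swapped): $a.m\xrightarrow{a}m$; $(?G,\gamma).m\xrightarrow{(?\ell,\gamma)}m$ if $\ell\in G$; $(!G,\gamma).m\xrightarrow{(!G,\gamma)}m$; $v\xrightarrow{a}v$; $\mathsf{rec}\,x.m\xrightarrow{\lambda}m'$ if $m\{\mathsf{rec}\,x.m/x\}\xrightarrow{\lambda}m'$; $m\odot n\xrightarrow{a}m'\odot n'$ if both move by $a$; $m\odot n\xrightarrow{(?\ell,\gamma)}m'\odot n'$ if both move by $(?\ell,\gamma)$; $m+n\xrightarrow{\lambda}m'$ if $m\xrightarrow{\lambda}m'$; $m\odot n\xrightarrow{(!G,\gamma)}m'\odot n$ if $m\xrightarrow{(!G,\gamma)}m'$; $m\odot n\xrightarrow{(?\ell,\gamma)}m'\odot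 n$ if $m\xrightarrow{(?\ell,\gamma)}m'$ and $n$ has no $(?\ell,\gamma)$-transition. Decentralized rules ($\diamond\in\{\wedge,\vee\}$, also swapped): $[m]_\ell\xrightarrow{\ell:(!G,\gamma)}[m']_\ell$ if $m\xrightarrow{(!G,\gamma)}m'$; $[m]_\ell\overset{G:(?\ell',\gamma)}{\rightsquigarrow}[m']_\ell$ if $m\xrightarrow{(?\ell',\gamma)}m'$ and $\ell\in G$; $[m]_\ell\overset{G:(?\ell',\gamma)}{\rightsquigarrow}[m]_\ell$ if $m$ has no $(?\ell',\gamma)$-transition or $\ell\notin G$; $M\diamond N\overset{G:(?\ell,\gamma)}{\rightsquigarrow}M'\diamond N'$ if both do; $M\diamond N\xrightarrow{\ell:(!G,\gamma)}M'\diamond N'$ if $M\xrightarrow{\ell:(!G,\gamma)}M'$ and $N\overset{G:(?\ell,\gamma)}{\rightsquigarrow}N'$; $[m]_\ell\xrightarrow{A}[m']_\ell$ if $A(\ell)=a$, $m\xrightarrow{a}m'$; $[m]_\ell\xrightarrow{A}[\mathsf{end}]_\ell$ if $A(\ell)=a$ and $m$ has neither an $a$-transition nor any communication-labelled transition; $M\diamond N\xrightarrow{A}M'\diamond N'$ if both move by $A$. Verdicts: $[m]_\ell\Rrightarrow v$ if $m\Rrightarrow v$; $M\diamond N\Rrightarrow\mathsf{end}$ if both $\Rrightarrow\mathsf{end}$; $M\wedge N\Rrightarrow\mathsf{no}$ if $M\Rrightarrow\mathsf{no}$; $M\wedge N\Rrightarrow v$ if $M\Rrightarrow\mathsf{yes}$,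 $N\Rrightarrow v$; $M\vee N\Rrightarrow\mathsf{yes}$ if $M\Rrightarrow\mathsf{yes}$; $M\vee N\Rrightarrow v$ if $M\Rrightarrow\mathsf{no}$, $N\Rrightarrow v$ (also swapped). Instrumentation: $M\triangleright T\rightarrowtail M'\triangleright T'$ if $M\xrightarrow{A}M'$, $T\xrightarrow{A}T'$; $M\triangleright T\rightarrowtail M'\triangleright T$ if $M\xrightarrow{\ell:(!G,\gamma)}M'$; $M\triangleright T\rightarrowtail v$ if $M\Rrightarrow v$; $\rightarrowtail^*$ reflexive-transitive closure. $M\Rightarrow_c M'$: $M'$ reached by finitely many (possibly zero) transitions labelled $\ell_i:(!G_i,\gamma_i)$. Weak bisimulation: a relation $\mathcal R$ between decentralized and centralized monitors such that whenever $M\,\mathcal R\,m$: (1) for every verdict $v$, there exists $M'$ with $M\Rightarrow_c M'$ and $M'\Rrightarrow v$ iff $m\Rrightarrow v$; (2) if $M\xrightarrow{A}M'$ then $m\xrightarrow{A}m'$ for some $m'$ with $M'\,\mathcal R\,m'$; (3) if $M\xrightarrow{\ell:(!G,\gamma)}M'$ then $M'\,\mathcal R\,m$; (4) if $m\xrightarrow{A}m'$ then $M\Rightarrow_c M_1\xrightarrow{A}M_2\Rightarrow_c M'$ for some $M_1,M_2,M'$ with $M'\,\mathcal R\,m'$. -}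

-- The whole development is parameterised by the sizes of the finite sets:
--   Act = Fin (2 + a)      (so |Act| ≥ 2)
--   Loc = Fin (1 + l)      (finite, non-empty set of locations)
--   Con = Act ⊎ Fin c      (finite set of communication constants, Con ⊇ Act)
module Defs where

open import Level using (Level; Lift; lift) renaming (suc to lsuc; zero to lzero)
open import Data.Nat using (ℕ; zero; suc; _≟_)
open import Data.Fin using (Fin)
import Data.Fin as F
open import Data.Fin.Subset using (Subset; _∈_; _∉_)
open import Data.Bool using (Bool; true; false; if_then_else_)
open import Data.Maybe using (Maybe; just; nothing; _>>=_; map)
open import Data.List using (List; []; _∷_; _++_; allFin; filter)
import Data.List as L
open import Data.List.Relation.Unary.All using (All)
open import Data.List.Relation.Unary.Unique.Propositional using (Unique)
open import Data.Product using (Σ; ∃; _×_; _,_)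
open import Data.Sum using (_⊎_)
open import Data.Empty using (⊥)
open import Data.Unit using (⊤)
open import Relation.Nullary using (¬_; does)
open import Relation.Binary.PropositionalEquality using (_≡_; _≢_)
open import Relation.Binary.Construct.Closure.ReflexiveTransitive using (Star)
open import Function.Bundles using (_⇔_)

module Setup (a l c : ℕ) where

  Act : Set
  Act = Fin (suc (suc a))

  Loc : Set
  Loc = Fin (suc l)

  Con : Set
  Con = Act ⊎ Fin c

  LVar : Set
  LVar = ℕ

  RVar : Set
  RVar = ℕ

  Trc : Set
  Trc = ℕ → Act

  HTrc : Set
  HTrc = Loc → Trc

  JAct : Set
  JAct = Loc → Act

  hd : HTrc → JAct
  hd T ℓ = T ℓ zero

  tl : HTrc → HTrc
  tl T ℓ n = T ℓ (suc n)

  _─[_]→ₜ_ : HTrc → JAct → HTrc → Set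
  T ─[ A ]→ₜ T' = (∀ ℓ → T ℓ zero ≡ A ℓ) × (∀ ℓ n → T ℓ (suc n) ≡ T' ℓ n)

  data Form : Set where
    tt ff     : Form
    _∧ᶠ_ _∨ᶠ_ : Form → Form → Form
    maxᶠ minᶠ : RVar → Form → Form
    varᶠ      : RVar → Form
    ∃ᶠ ∀ᶠ     : LVar → Form → Form
    _=ᶠ_ _≠ᶠ_ : LVar → LVar → Form
    [_at_]ᶠ   : Act → LVar → Form → Form
    ⟨_at_⟩ᶠ   : Act → LVar → Form → Form

  FreeL : LVar → Form → Set
  FreeL π tt = ⊥
  FreeL π ff = ⊥
  FreeL π (φ ∧ᶠ ψ) = FreeL π φ ⊎ FreeL π ψ
  FreeL π (φ ∨ᶠ ψ) = FreeL π φ ⊎ FreeL π ψ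
  FreeL π (maxᶠ x φ) = FreeL π φ
  FreeL π (minᶠ x φ) = FreeL π φ
  FreeL π (varᶠ x) = ⊥
  FreeL π (∃ᶠ π' φ) = π ≢ π' × FreeL π φ
  FreeL π (∀ᶠ π' φ) = π ≢ π' × FreeL π φ
  FreeL π (π₁ =ᶠ π₂) = π ≡ π₁ ⊎ π ≡ π₂
  FreeL π (π₁ ≠ᶠ π₂) = π ≡ π₁ ⊎ π ≡ π₂
  FreeL π ([ b at π' ]ᶠ φ) = π ≡ π' ⊎ FreeL π φ
  FreeL π (⟨ b at π' ⟩ᶠ φ) = π ≡ π' ⊎ FreeL π φ

  FreeR : RVar → Form → Set
  FreeR x tt = ⊥
  FreeR x ff = ⊥
  FreeR x (φ ∧ᶠ ψ) = FreeR x φ ⊎ FreeR x ψ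
  FreeR x (φ ∨ᶠ ψ) = FreeR x φ ⊎ FreeR x ψ
  FreeR x (maxᶠ y φ) = x ≢ y × FreeR x φ
  FreeR x (minᶠ y φ) = x ≢ y × FreeR x φ
  FreeR x (varᶠ y) = x ≡ y
  FreeR x (∃ᶠ π φ) = FreeR x φ
  FreeR x (∀ᶠ π φ) = FreeR x φ
  FreeR x (π₁ =ᶠ π₂) = ⊥
  FreeR x (π₁ ≠ᶠ π₂) = ⊥
  FreeR x ([ b at π ]ᶠ φ) = FreeR x φ
  FreeR x (⟨ b at π ⟩ᶠ φ) = FreeR x φ

  Unguarded : RVar → Form → Set
  Unguarded x tt = ⊥
  Unguarded x ff = ⊥
  Unguarded x (φ ∧ᶠ ψ) = Unguarded x φ ⊎ Unguarded x ψ
  Unguarded x (φ ∨ᶠ ψ) = Unguarded x φ ⊎ Unguarded x ψ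
  Unguarded x (maxᶠ y φ) = x ≢ y × Unguarded x φ
  Unguarded x (minᶠ y φ) = x ≢ y × Unguarded x φ
  Unguarded x (varᶠ y) = x ≡ y
  Unguarded x (∃ᶠ π φ) = Unguarded x φ
  Unguarded x (∀ᶠ π φ) = Unguarded x φ
  Unguarded x (π₁ =ᶠ π₂) = ⊥
  Unguarded x (π₁ ≠ᶠ π₂) = ⊥
  Unguarded x ([ b at π ]ᶠ φ) = ⊥
  Unguarded x (⟨ b at π ⟩ᶠ φ) = ⊥

  Guarded : Form → Set
  Guarded tt = ⊤
  Guarded ff = ⊤
  Guarded (φ ∧ᶠ ψ) = Guarded φ × Guarded ψ
  Guarded (φ ∨ᶠ ψ) = Guarded φ × Guarded ψ
  Guarded (maxᶠ x φ) = ¬ Unguarded x φ × Guarded φ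
  Guarded (minᶠ x φ) = ¬ Unguarded x φ × Guarded φ
  Guarded (varᶠ x) = ⊤
  Guarded (∃ᶠ π φ) = Guarded φ
  Guarded (∀ᶠ π φ) = Guarded φ
  Guarded (π₁ =ᶠ π₂) = ⊤
  Guarded (π₁ ≠ᶠ π₂) = ⊤
  Guarded ([ b at π ]ᶠ φ) = Guarded φ
  Guarded (⟨ b at π ⟩ᶠ φ) = Guarded φ

  boundL : Form → List LVar
  boundL tt = []
  boundL ff = []
  boundL (φ ∧ᶠ ψ) = boundL φ ++ boundL ψ
  boundL (φ ∨ᶠ ψ) = boundL φ ++ boundL ψ
  boundL (maxᶠ x φ) = boundL φ
  boundL (minᶠ x φ) = boundL φ
  boundL (varᶠ x) = []
  boundL (∃ᶠ π φ) = π ∷ boundL φ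
  boundL (∀ᶠ π φ) = π ∷ boundL φ
  boundL (π₁ =ᶠ π₂) = []
  boundL (π₁ ≠ᶠ π₂) = []
  boundL ([ b at π ]ᶠ φ) = boundL φ
  boundL (⟨ b at π ⟩ᶠ φ) = boundL φ

  WellFormed : Form → Set
  WellFormed φ = Guarded φ × Unique (boundL φ) × All (λ π → ¬ FreeL π φ) (boundL φ)

  Closed : Form → Set
  Closed φ = (∀ π → ¬ FreeL π φ) × (∀ x → ¬ FreeR x φ)

  MaxHML : Form → Set
  MaxHML tt = ⊤
  MaxHML ff = ⊤
  MaxHML (φ ∧ᶠ ψ) = MaxHML φ × MaxHML ψ
  MaxHML (φ ∨ᶠ ψ) = MaxHML φ × MaxHML ψ
  MaxHML (maxᶠ x φ) = MaxHML φ
  MaxHML (minᶠ x φ) = ⊥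
  MaxHML (varᶠ x) = ⊤
  MaxHML (∃ᶠ π φ) = MaxHML φ
  MaxHML (∀ᶠ π φ) = MaxHML φ
  MaxHML (π₁ =ᶠ π₂) = ⊤
  MaxHML (π₁ ≠ᶠ π₂) = ⊤
  MaxHML ([ b at π ]ᶠ φ) = MaxHML φ
  MaxHML (⟨ b at π ⟩ᶠ φ) = MaxHML φ

  HSet : Set₁
  HSet = HTrc → Set

  Env : Set₁
  Env = RVar → Maybe HSet

  Assign : Set
  Assign = LVar → Maybe Loc

  ∅ρ : Env
  ∅ρ _ = nothing

  ∅σ : Assign
  ∅σ _ = nothing

  _[_↦ρ_] : Env → RVar → HSet → Env
  (ρ [ x ↦ρ S ]) y = if does (x ≟ y) then just S else ρ y

  _[_↦σ_] : Assign → LVar → Loc → Assign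
  (σ [ π ↦σ ℓ ]) π' = if does (π ≟ π') then just ℓ else σ π'

  inρ : Maybe HSet → HTrc → Set
  inρ nothing T = ⊥
  inρ (just S) T = S T

  ⟦_⟧ : Form → Env → Assign → HTrc → Set₁
  ⟦ tt ⟧ ρ σ T = Lift (lsuc lzero) ⊤
  ⟦ ff ⟧ ρ σ T = Lift (lsuc lzero) ⊥
  ⟦ φ ∧ᶠ ψ ⟧ ρ σ T = ⟦ φ ⟧ ρ σ T × ⟦ ψ ⟧ ρ σ T
  ⟦ φ ∨ᶠ ψ ⟧ ρ σ T = ⟦ φ ⟧ ρ σ T ⊎ ⟦ ψ ⟧ ρ σ T
  -- ⋃ { S | S ⊆ ⟦ψ⟧^{ρ[x↦S]} }
  ⟦ maxᶠ x ψ ⟧ ρ σ T =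
    Σ HSet λ S → (∀ T' → S T' → ⟦ ψ ⟧ (ρ [ x ↦ρ S ]) σ T') × S T
  -- ⋂ { S | S ⊇ ⟦ψ⟧^{ρ[x↦S]} }
  ⟦ minᶠ x ψ ⟧ ρ σ T =
    (S : HSet) → (∀ T' → ⟦ ψ ⟧ (ρ [ x ↦ρ S ]) σ T' → S T') → Lift (lsuc lzero) (S T)
  ⟦ varᶠ x ⟧ ρ σ T = Lift (lsuc lzero) (inρ (ρ x) T)
  ⟦ ∃ᶠ π ψ ⟧ ρ σ T = Σ Loc λ ℓ → ⟦ ψ ⟧ ρ (σ [ π ↦σ ℓ ]) T
  ⟦ ∀ᶠ π ψ ⟧ ρ σ T = (ℓ : Loc) → ⟦ ψ ⟧ ρ (σ [ π ↦σ ℓ ]) T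
  ⟦ π₁ =ᶠ π₂ ⟧ ρ σ T = Lift (lsuc lzero) (Σ Loc λ ℓ → σ π₁ ≡ just ℓ × σ π₂ ≡ just ℓ)
  ⟦ π₁ ≠ᶠ π₂ ⟧ ρ σ T =
    Lift (lsuc lzero) (Σ Loc λ ℓ₁ → Σ Loc λ ℓ₂ → σ π₁ ≡ just ℓ₁ × σ π₂ ≡ just ℓ₂ × ℓ₁ ≢ ℓ₂)
  ⟦ [ b at π ]ᶠ ψ ⟧ ρ σ T =
    Σ Loc λ ℓ → Lift (lsuc lzero) (σ π ≡ just ℓ) × (hd T ℓ ≡ b → ⟦ ψ ⟧ ρ σ (tl T))
  ⟦ ⟨ b at π ⟩ᶠ ψ ⟧ ρ σ T =
    Σ Loc λ ℓ → Lift (lsuc lzero) (σ π ≡ just ℓ) × Lift (lsuc lzero) (hd T ℓ ≡ b) × ⟦ ψ ⟧ ρ σ (tl T)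

  ⟦_⟧₀ : Form → HTrc → Set₁
  ⟦ φ ⟧₀ = ⟦ φ ⟧ ∅ρ ∅σ

  data Verdict : Set where
    yes no end : Verdict

  data CMon : Set where
    verdᶜ       : Verdict → CMon
    _at_∙ᶜ_     : Act → Loc → CMon → CMon
    _+ᶜ_ _⊕ᶜ_ _⊗ᶜ_ : CMon → CMon → CMon
    recᶜ        : RVar → CMon → CMon
    varᶜ        : RVar → CMon

  substᶜ : CMon → RVar → CMon → CMon
  substᶜ (verdᶜ v) x n = verdᶜ v
  substᶜ (b at ℓ ∙ᶜ m) x n = b at ℓ ∙ᶜ substᶜ m x n
  substᶜ (m +ᶜ m') x n = substᶜ m x n +ᶜ substᶜ m' x n
  substᶜ (m ⊕ᶜ m') x n = substᶜ m x n ⊕ᶜ substᶜ m' x n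
  substᶜ (m ⊗ᶜ m') x n = substᶜ m x n ⊗ᶜ substᶜ m' x n
  substᶜ (recᶜ y m) x n = if does (x ≟ y) then recᶜ y m else recᶜ y (substᶜ m x n)
  substᶜ (varᶜ y) x n = if does (x ≟ y) then n else varᶜ y

  unfoldᶜ : RVar → CMon → CMon
  unfoldᶜ x m = substᶜ m x (recᶜ x m)

  data _─[_]→ᶜ_ : CMon → JAct → CMon → Set where
    c-verd  : ∀ {v A} → verdᶜ v ─[ A ]→ᶜ verdᶜ v
    c-act   : ∀ {b ℓ m A} → A ℓ ≡ b → (b at ℓ ∙ᶜ m) ─[ A ]→ᶜ m
    c-actE  : ∀ {b ℓ m A} → A ℓ ≢ b → (b at ℓ ∙ᶜ m) ─[ A ]→ᶜ verdᶜ end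
    c-rec   : ∀ {x m m' A} → unfoldᶜ x m ─[ A ]→ᶜ m' → recᶜ x m ─[ A ]→ᶜ m'
    c-sumL  : ∀ {m n m' A} → m ─[ A ]→ᶜ m' → (m +ᶜ n) ─[ A ]→ᶜ m'
    c-sumR  : ∀ {m n n' A} → n ─[ A ]→ᶜ n' → (m +ᶜ n) ─[ A ]→ᶜ n'
    c-⊕     : ∀ {m n m' n' A} → m ─[ A ]→ᶜ m' → n ─[ A ]→ᶜ n' → (m ⊕ᶜ n) ─[ A ]→ᶜ (m' ⊕ᶜ n')
    c-⊗     : ∀ {m n m' n' A} → m ─[ A ]→ᶜ m' → n ─[ A ]→ᶜ n' → (m ⊗ᶜ n) ─[ A ]→ᶜ (m' ⊗ᶜ n')

  data _⇛ᶜ_ : CMon → Verdict → Set where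
    e-verd   : ∀ {v} → verdᶜ v ⇛ᶜ v
    e-⊕end   : ∀ {m n} → m ⇛ᶜ end → n ⇛ᶜ end → (m ⊕ᶜ n) ⇛ᶜ end
    e-⊗end   : ∀ {m n} → m ⇛ᶜ end → n ⇛ᶜ end → (m ⊗ᶜ n) ⇛ᶜ end
    e-⊕yesL  : ∀ {m n} → m ⇛ᶜ yes → (m ⊕ᶜ n) ⇛ᶜ yes
    e-⊕yesR  : ∀ {m n} → n ⇛ᶜ yes → (m ⊕ᶜ n) ⇛ᶜ yes
    e-⊗noL   : ∀ {m n} → m ⇛ᶜ no → (m ⊗ᶜ n) ⇛ᶜ no
    e-⊗noR   : ∀ {m n} → n ⇛ᶜ no → (m ⊗ᶜ n) ⇛ᶜ no
    e-sumL   : ∀ {m n v} → m ⇛ᶜ v → (m +ᶜ n) ⇛ᶜ v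
    e-sumR   : ∀ {m n v} → n ⇛ᶜ v → (m +ᶜ n) ⇛ᶜ v
    e-⊕noL   : ∀ {m n v} → m ⇛ᶜ no → n ⇛ᶜ v → (m ⊕ᶜ n) ⇛ᶜ v
    e-⊕noR   : ∀ {m n v} → n ⇛ᶜ no → m ⇛ᶜ v → (m ⊕ᶜ n) ⇛ᶜ v
    e-⊗yesL  : ∀ {m n v} → m ⇛ᶜ yes → n ⇛ᶜ v → (m ⊗ᶜ n) ⇛ᶜ v
    e-⊗yesR  : ∀ {m n v} → n ⇛ᶜ yes → m ⇛ᶜ v → (m ⊗ᶜ n) ⇛ᶜ v
    e-rec    : ∀ {x m v} → unfoldᶜ x m ⇛ᶜ v → recᶜ x m ⇛ᶜ v

  -- Centralized synthesis M_σ (partial: defined on Hyper-maxHML formulas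
  -- with σ defined on the free location variables)

  bigop : (CMon → CMon → CMon) → List (Maybe CMon) → Maybe CMon
  bigop op [] = nothing
  bigop op (m ∷ []) = m
  bigop op (m ∷ ms@(_ ∷ _)) = m >>= λ m' → bigop op ms >>= λ r → just (op m' r)

  sumᶜ : CMon → List CMon → CMon
  sumᶜ m [] = m
  sumᶜ m (n ∷ ns) = m +ᶜ sumᶜ n ns

  others : Act → List Act
  others b = filter (λ b' → Relation.Nullary.¬? (b' F.≟ b)) (allFin _)

  synth : Assign → Form → Maybe CMon
  synth σ tt = just (verdᶜ yes)
  synth σ ff = just (verdᶜ no)
  synth σ (φ ∧ᶠ ψ) = synth σ φ >>= λ m → synth σ ψ >>= λ n → just (m ⊗ᶜ n)
  synth σ (φ ∨ᶠ ψ) = synth σ φ >>= λ m → synth σ ψ >>= λ n → just (m ⊕ᶜ n)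
  synth σ (maxᶠ x φ) = map (recᶜ x) (synth σ φ)
  synth σ (minᶠ x φ) = nothing
  synth σ (varᶠ x) = just (varᶜ x)
  synth σ (∃ᶠ π φ) = bigop _⊕ᶜ_ (L.map (λ ℓ → synth (σ [ π ↦σ ℓ ]) φ) (allFin _))
  synth σ (∀ᶠ π φ) = bigop _⊗ᶜ_ (L.map (λ ℓ → synth (σ [ π ↦σ ℓ ]) φ) (allFin _))
  synth σ (π₁ =ᶠ π₂) = σ π₁ >>= λ ℓ₁ → σ π₂ >>= λ ℓ₂ →
    just (if does (ℓ₁ F.≟ ℓ₂) then verdᶜ yes else verdᶜ no)
  synth σ (π₁ ≠ᶠ π₂) = σ π₁ >>= λ ℓ₁ → σ π₂ >>= λ ℓ₂ →
    just (if does (ℓ₁ F.≟ ℓ₂) then verdᶜ no else verdᶜ yes)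
  synth σ ([ b at π ]ᶠ φ) = σ π >>= λ ℓ → synth σ φ >>= λ m →
    just (sumᶜ (b at ℓ ∙ᶜ m) (L.map (λ b' → b' at ℓ ∙ᶜ verdᶜ yes) (others b)))
  synth σ (⟨ b at π ⟩ᶠ φ) = σ π >>= λ ℓ → synth σ φ >>= λ m →
    just (sumᶜ (b at ℓ ∙ᶜ m) (L.map (λ b' → b' at ℓ ∙ᶜ verdᶜ no) (others b)))

  data Comm : Set where
    send : Subset (suc l) → Con → Comm
    recv : Subset (suc l) → Con → Comm

  data LMon : Set where
    verdˡ          : Verdict → LMon
    _∙ˡ_           : Act → LMon → LMon
    _⋆ˡ_           : Comm → LMon → LMon
    _+ˡ_ _⊕ˡ_ _⊗ˡ_ : LMon → LMon → LMon
    recˡ           : RVar → LMon → LMon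
    varˡ           : RVar → LMon

  substˡ : LMon → RVar → LMon → LMon
  substˡ (verdˡ v) x n = verdˡ v
  substˡ (b ∙ˡ m) x n = b ∙ˡ substˡ m x n
  substˡ (κ ⋆ˡ m) x n = κ ⋆ˡ substˡ m x n
  substˡ (m +ˡ m') x n = substˡ m x n +ˡ substˡ m' x n
  substˡ (m ⊕ˡ m') x n = substˡ m x n ⊕ˡ substˡ m' x n
  substˡ (m ⊗ˡ m') x n = substˡ m x n ⊗ˡ substˡ m' x n
  substˡ (recˡ y m) x n = if does (x ≟ y) then recˡ y m else recˡ y (substˡ m x n)
  substˡ (varˡ y) x n = if does (x ≟ y) then n else varˡ y

  unfoldˡ : RVar → LMon → LMon
  unfoldˡ x m = substˡ m x (recˡ x m)

  data Label : Set where
    lact  : Act → Label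
    lsend : Subset (suc l) → Con → Label
    lrecv : Loc → Con → Label

  -- "m has a (?ℓ,γ)-transition", characterised positively
  data CanRecv (ℓ : Loc) (γ : Con) : LMon → Set where
    cr-pre  : ∀ {G m} → ℓ ∈ G → CanRecv ℓ γ (recv G γ ⋆ˡ m)
    cr-rec  : ∀ {x m} → CanRecv ℓ γ (unfoldˡ x m) → CanRecv ℓ γ (recˡ x m)
    cr-sumL : ∀ {m n} → CanRecv ℓ γ m → CanRecv ℓ γ (m +ˡ n)
    cr-sumR : ∀ {m n} → CanRecv ℓ γ n → CanRecv ℓ γ (m +ˡ n)
    cr-⊕L   : ∀ {m n} → CanRecv ℓ γ m → CanRecv ℓ γ (m ⊕ˡ n)
    cr-⊕R   : ∀ {m n} → CanRecv ℓ γ n → CanRecv ℓ γ (m ⊕ˡ n)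
    cr-⊗L   : ∀ {m n} → CanRecv ℓ γ m → CanRecv ℓ γ (m ⊗ˡ n)
    cr-⊗R   : ∀ {m n} → CanRecv ℓ γ n → CanRecv ℓ γ (m ⊗ˡ n)

  data _─[_]→ˡ_ : LMon → Label → LMon → Set where
    l-act    : ∀ {b m} → (b ∙ˡ m) ─[ lact b ]→ˡ m
    l-recv   : ∀ {G γ ℓ m} → ℓ ∈ G → (recv G γ ⋆ˡ m) ─[ lrecv ℓ γ ]→ˡ m
    l-send   : ∀ {G γ m} → (send G γ ⋆ˡ m) ─[ lsend G γ ]→ˡ m
    l-verd   : ∀ {v b} → verdˡ v ─[ lact b ]→ˡ verdˡ v
    l-rec    : ∀ {x m m' λ'} → unfoldˡ x m ─[ λ' ]→ˡ m' → recˡ x m ─[ λ' ]→ˡ m'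
    l-⊕act   : ∀ {m n m' n' b} → m ─[ lact b ]→ˡ m' → n ─[ lact b ]→ˡ n' → (m ⊕ˡ n) ─[ lact b ]→ˡ (m' ⊕ˡ n')
    l-⊗act   : ∀ {m n m' n' b} → m ─[ lact b ]→ˡ m' → n ─[ lact b ]→ˡ n' → (m ⊗ˡ n) ─[ lact b ]→ˡ (m' ⊗ˡ n')
    l-⊕recv  : ∀ {m n m' n' ℓ γ} → m ─[ lrecv ℓ γ ]→ˡ m' → n ─[ lrecv ℓ γ ]→ˡ n' → (m ⊕ˡ n) ─[ lrecv ℓ γ ]→ˡ (m' ⊕ˡ n')
    l-⊗recv  : ∀ {m n m' n' ℓ γ} → m ─[ lrecv ℓ γ ]→ˡ m' → n ─[ lrecv ℓ γ ]→ˡ n' → (m ⊗ˡ n) ─[ lrecv ℓ γ ]→ˡ (m' ⊗ˡ n')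
    l-sumL   : ∀ {m n m' λ'} → m ─[ λ' ]→ˡ m' → (m +ˡ n) ─[ λ' ]→ˡ m'
    l-sumR   : ∀ {m n n' λ'} → n ─[ λ' ]→ˡ n' → (m +ˡ n) ─[ λ' ]→ˡ n'
    l-⊕sendL : ∀ {m n m' G γ} → m ─[ lsend G γ ]→ˡ m' → (m ⊕ˡ n) ─[ lsend G γ ]→ˡ (m' ⊕ˡ n)
    l-⊕sendR : ∀ {m n n' G γ} → n ─[ lsend G γ ]→ˡ n' → (m ⊕ˡ n) ─[ lsend G γ ]→ˡ (m ⊕ˡ n')
    l-⊗sendL : ∀ {m n m' G γ} → m ─[ lsend G γ ]→ˡ m' → (m ⊗ˡ n) ─[ lsend G γ ]→ˡ (m' ⊗ˡ n)
    l-⊗sendR : ∀ {m n n' G γ} → n ─[ lsend G γ ]→ˡ n' → (m ⊗ˡ n) ─[ lsend G γ ]→ˡ (m ⊗ˡ n')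
    l-⊕recvL : ∀ {m n m' ℓ γ} → m ─[ lrecv ℓ γ ]→ˡ m' → ¬ CanRecv ℓ γ n → (m ⊕ˡ n) ─[ lrecv ℓ γ ]→ˡ (m' ⊕ˡ n)
    l-⊕recvR : ∀ {m n n' ℓ γ} → n ─[ lrecv ℓ γ ]→ˡ n' → ¬ CanRecv ℓ γ m → (m ⊕ˡ n) ─[ lrecv ℓ γ ]→ˡ (m ⊕ˡ n')
    l-⊗recvL : ∀ {m n m' ℓ γ} → m ─[ lrecv ℓ γ ]→ˡ m' → ¬ CanRecv ℓ γ n → (m ⊗ˡ n) ─[ lrecv ℓ γ ]→ˡ (m' ⊗ˡ n)
    l-⊗recvR : ∀ {m n n' ℓ γ} → n ─[ lrecv ℓ γ ]→ˡ n' → ¬ CanRecv ℓ γ m → (m ⊗ˡ n) ─[ lrecv ℓ γ ]→ˡ (m ⊗ˡ n')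

  data _⇛ˡ_ : LMon → Verdict → Set where
    e-verd   : ∀ {v} → verdˡ v ⇛ˡ v
    e-⊕end   : ∀ {m n} → m ⇛ˡ end → n ⇛ˡ end → (m ⊕ˡ n) ⇛ˡ end
    e-⊗end   : ∀ {m n} → m ⇛ˡ end → n ⇛ˡ end → (m ⊗ˡ n) ⇛ˡ end
    e-⊕yesL  : ∀ {m n} → m ⇛ˡ yes → (m ⊕ˡ n) ⇛ˡ yes
    e-⊕yesR  : ∀ {m n} → n ⇛ˡ yes → (m ⊕ˡ n) ⇛ˡ yes
    e-⊗noL   : ∀ {m n} → m ⇛ˡ no → (m ⊗ˡ n) ⇛ˡ no
    e-⊗noR   : ∀ {m n} → n ⇛ˡ no → (m ⊗ˡ n) ⇛ˡ no
    e-sumL   : ∀ {m n v} → m ⇛ˡ v → (m +ˡ n) ⇛ˡ v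
    e-sumR   : ∀ {m n v} → n ⇛ˡ v → (m +ˡ n) ⇛ˡ v
    e-⊕noL   : ∀ {m n v} → m ⇛ˡ no → n ⇛ˡ v → (m ⊕ˡ n) ⇛ˡ v
    e-⊕noR   : ∀ {m n v} → n ⇛ˡ no → m ⇛ˡ v → (m ⊕ˡ n) ⇛ˡ v
    e-⊗yesL  : ∀ {m n v} → m ⇛ˡ yes → n ⇛ˡ v → (m ⊗ˡ n) ⇛ˡ v
    e-⊗yesR  : ∀ {m n v} → n ⇛ˡ yes → m ⇛ˡ v → (m ⊗ˡ n) ⇛ˡ v
    e-rec    : ∀ {x m v} → unfoldˡ x m ⇛ˡ v → recˡ x m ⇛ˡ v

  data DMon : Set where
    [_]_    : LMon → Loc → DMon
    _∨ᵈ_ _∧ᵈ_ : DMon → DMon → DMon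

  HasComm : LMon → Set
  HasComm m = (Σ (Subset (suc l)) λ G → Σ Con λ γ → Σ LMon λ m' → m ─[ lsend G γ ]→ˡ m')
            ⊎ (Σ Loc λ ℓ → Σ Con λ γ → Σ LMon λ m' → m ─[ lrecv ℓ γ ]→ˡ m')

  data _⇝[_∶_,_]_ : DMon → Subset (suc l) → Loc → Con → DMon → Set where
    d-recv   : ∀ {m m' ℓ ℓ' G γ} → m ─[ lrecv ℓ' γ ]→ˡ m' → ℓ ∈ G →
               ([ m ] ℓ) ⇝[ G ∶ ℓ' , γ ] ([ m' ] ℓ)
    d-skip   : ∀ {m ℓ ℓ' G γ} → ((¬ Σ LMon λ m' → m ─[ lrecv ℓ' γ ]→ˡ m') ⊎ ℓ ∉ G) →
               ([ m ] ℓ) ⇝[ G ∶ ℓ' , γ ] ([ m ] ℓ)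
    d-∨      : ∀ {M N M' N' G ℓ γ} → M ⇝[ G ∶ ℓ , γ ] M' → N ⇝[ G ∶ ℓ , γ ] N' →
               (M ∨ᵈ N) ⇝[ G ∶ ℓ , γ ] (M' ∨ᵈ N')
    d-∧      : ∀ {M N M' N' G ℓ γ} → M ⇝[ G ∶ ℓ , γ ] M' → N ⇝[ G ∶ ℓ , γ ] N' →
               (M ∧ᵈ N) ⇝[ G ∶ ℓ , γ ] (M' ∧ᵈ N')

  data _─[_∶!_,_]→ᵈ_ : DMon → Loc → Subset (suc l) → Con → DMon → Set where
    d-send   : ∀ {m m' ℓ G γ} → m ─[ lsend G γ ]→ˡ m' → ([ m ] ℓ) ─[ ℓ ∶! G , γ ]→ᵈ ([ m' ] ℓ)
    d-∨L     : ∀ {M N M' N' ℓ G γ} → M ─[ ℓ ∶! G , γ ]→ᵈ M' → N ⇝[ G ∶ ℓ , γ ] N' →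
               (M ∨ᵈ N) ─[ ℓ ∶! G , γ ]→ᵈ (M' ∨ᵈ N')
    d-∨R     : ∀ {M N M' N' ℓ G γ} → N ─[ ℓ ∶! G , γ ]→ᵈ N' → M ⇝[ G ∶ ℓ , γ ] M' →
               (M ∨ᵈ N) ─[ ℓ ∶! G , γ ]→ᵈ (M' ∨ᵈ N')
    d-∧L     : ∀ {M N M' N' ℓ G γ} → M ─[ ℓ ∶! G , γ ]→ᵈ M' → N ⇝[ G ∶ ℓ , γ ] N' →
               (M ∧ᵈ N) ─[ ℓ ∶! G , γ ]→ᵈ (M' ∧ᵈ N')
    d-∧R     : ∀ {M N M' N' ℓ G γ} → N ─[ ℓ ∶! G , γ ]→ᵈ N' → M ⇝[ G ∶ ℓ , γ ] M' →
               (M ∧ᵈ N) ─[ ℓ ∶! G , γ ]→ᵈ (M' ∧ᵈ N')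

  data _─[_]→ᵈ_ : DMon → JAct → DMon → Set where
    d-act    : ∀ {m m' ℓ A} → m ─[ lact (A ℓ) ]→ˡ m' → ([ m ] ℓ) ─[ A ]→ᵈ ([ m' ] ℓ)
    d-end    : ∀ {m ℓ A} → (¬ Σ LMon λ m' → m ─[ lact (A ℓ) ]→ˡ m') → ¬ HasComm m →
               ([ m ] ℓ) ─[ A ]→ᵈ ([ verdˡ end ] ℓ)
    d-∨      : ∀ {M N M' N' A} → M ─[ A ]→ᵈ M' → N ─[ A ]→ᵈ N' → (M ∨ᵈ N) ─[ A ]→ᵈ (M' ∨ᵈ N')
    d-∧      : ∀ {M N M' N' A} → M ─[ A ]→ᵈ M' → N ─[ A ]→ᵈ N' → (M ∧ᵈ N) ─[ A ]→ᵈ (M' ∧ᵈ N')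

  data _⇛ᵈ_ : DMon → Verdict → Set where
    e-loc    : ∀ {m ℓ v} → m ⇛ˡ v → ([ m ] ℓ) ⇛ᵈ v
    e-∨end   : ∀ {M N} → M ⇛ᵈ end → N ⇛ᵈ end → (M ∨ᵈ N) ⇛ᵈ end
    e-∧end   : ∀ {M N} → M ⇛ᵈ end → N ⇛ᵈ end → (M ∧ᵈ N) ⇛ᵈ end
    e-∧noL   : ∀ {M N} → M ⇛ᵈ no → (M ∧ᵈ N) ⇛ᵈ no
    e-∧noR   : ∀ {M N} → N ⇛ᵈ no → (M ∧ᵈ N) ⇛ᵈ no
    e-∧yesL  : ∀ {M N v} → M ⇛ᵈ yes → N ⇛ᵈ v → (M ∧ᵈ N) ⇛ᵈ v
    e-∧yesR  : ∀ {M N v} → N ⇛ᵈ yes → M ⇛ᵈ v → (M ∧ᵈ N) ⇛ᵈ v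
    e-∨yesL  : ∀ {M N} → M ⇛ᵈ yes → (M ∨ᵈ N) ⇛ᵈ yes
    e-∨yesR  : ∀ {M N} → N ⇛ᵈ yes → (M ∨ᵈ N) ⇛ᵈ yes
    e-∨noL   : ∀ {M N v} → M ⇛ᵈ no → N ⇛ᵈ v → (M ∨ᵈ N) ⇛ᵈ v
    e-∨noR   : ∀ {M N v} → N ⇛ᵈ no → M ⇛ᵈ v → (M ∨ᵈ N) ⇛ᵈ v

  data Conf : Set where
    _▷_  : DMon → HTrc → Conf
    verd : Verdict → Conf

  data _↣_ : Conf → Conf → Set where
    i-act  : ∀ {M M' T T' A} → M ─[ A ]→ᵈ M' → T ─[ A ]→ₜ T' → (M ▷ T) ↣ (M' ▷ T')
    i-send : ∀ {M M' T ℓ G γ} → M ─[ ℓ ∶! G , γ ]→ᵈ M' → (M ▷ T) ↣ (M' ▷ T)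
    i-verd : ∀ {M T v} → M ⇛ᵈ v → (M ▷ T) ↣ verd v

  _↣*_ : Conf → Conf → Set
  _↣*_ = Star _↣_

  CommStep : DMon → DMon → Set
  CommStep M M' = Σ Loc λ ℓ → Σ (Subset (suc l)) λ G → Σ Con λ γ → M ─[ ℓ ∶! G , γ ]→ᵈ M'

  _⇒c_ : DMon → DMon → Set
  _⇒c_ = Star CommStep

  record WeakBisim (R : DMon → CMon → Set) : Set where
    field
      wb-verdict : ∀ {M m} → R M m → (v : Verdict) →
                   (Σ DMon λ M' → M ⇒c M' × M' ⇛ᵈ v) ⇔ (m ⇛ᶜ v)
      wb-act     : ∀ {M m} → R M m → ∀ {A M'} → M ─[ A ]→ᵈ M' →
                   Σ CMon λ m' → m ─[ A ]→ᶜ m' × R M' m'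
      wb-send    : ∀ {M m} → R M m → ∀ {ℓ G γ M'} → M ─[ ℓ ∶! G , γ ]→ᵈ M' → R M' m
      wb-sim     : ∀ {M m} → R M m → ∀ {A m'} → m ─[ A ]→ᶜ m' →
                   Σ DMon λ M₁ → Σ DMon λ M₂ → Σ DMon λ M' →
                     M ⇒c M₁ × M₁ ─[ A ]→ᵈ M₂ × M₂ ⇒c M' × R M' m'

{-# OPTIONS --safe #-}
-- A decentralised run reaching a verdict is matched by a run of the centralised monitor
-- M_∅(φ) reaching the same verdict (weak bisimulation: communication steps are invisible,
-- trace steps and verdicts are simulated), so it suffices that centralised verdicts are sound.
-- The monitor of a subformula ψ is run with each free recursion variable x instantiated by
-- rec x.m, the monitor of its binder max x.ψ'. Acceptance: the traces accepted by rec x.m form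
-- a post-fixed point of ψ', hence lie in max x.ψ'. Rejection: induction on the length of the
-- rejecting run; by guardedness a modality consumes a trace step between max x.ψ' and any
-- occurrence of x, so the run of rec x.m found at x is strictly shorter.
module Submission where

open import Defs
open import Level using (lift)
open import Function using (_∘_; id; case_of_)
open import Function.Bundles using (Equivalence)
open import Data.Nat using (ℕ; zero; suc; _≟_; _<_)
open import Data.Nat.Properties using (<-trans; n<1+n)
open import Data.Nat.Induction using (<-rec)
open import Data.Bool using (true; false; if_then_else_)
open import Data.Bool.Properties using (if-eta)
import Data.Fin as Fin
open import Data.Maybe using (Maybe; just; nothing; _>>=_; fromMaybe)
import Data.Maybe as Maybe
open import Data.Maybe.Properties using (just-injective)
open import Data.List using (List; []; _∷_; allFin)
import Data.List as List
open import Data.List.Membership.Propositional using (_∈_)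
open import Data.List.Membership.Propositional.Properties using (∈-allFin; ∈-filter⁻)
open import Data.List.Relation.Unary.All as All using (All; []; _∷_)
open import Data.List.Relation.Unary.Any using (Any; here; there)
open import Data.Product as Product using (∃; ∃₂; _×_; _,_; proj₁; proj₂)
open import Data.Sum as Sum using (_⊎_; inj₁; inj₂; [_,_]′)
open import Data.Empty using (⊥; ⊥-elim)
import Data.Unit as Unit
open import Relation.Nullary using (¬_; Dec; does; proof; ofʸ; ofⁿ; ¬?)
  renaming (yes to yes′; no to no′)
open import Relation.Nullary.Decidable using (dec-true; dec-false)
open import Relation.Binary.PropositionalEquality
  using (_≡_; _≢_; refl; sym; trans; cong; cong₂; subst; module ≡-Reasoning)
open import Relation.Binary.Construct.Closure.ReflexiveTransitive using (ε; _◅_)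

module _ {ℓ} {A : Set ℓ} {u v : A} where

  if-≟-same : ∀ x → (if does (x ≟ x) then u else v) ≡ u
  if-≟-same x rewrite dec-true (x ≟ x) refl = refl

  if-≟-other : ∀ {x y} → x ≢ y → (if does (x ≟ y) then u else v) ≡ v
  if-≟-other {x} {y} x≢y rewrite dec-false (x ≟ y) x≢y = refl

just-unique : ∀ {A : Set} {x : Maybe A} {a a' : A} → x ≡ just a → x ≡ just a' → a ≡ a'
just-unique x≡a x≡a' = just-injective (trans (sym x≡a) x≡a')

module _ {A B : Set} where

  map-just : (f : A → B) (x : Maybe A) {b : B} → Maybe.map f x ≡ just b → ∃ λ a → x ≡ just a × f a ≡ b
  map-just f (just a) refl = a , refl , refl
  map-just f nothing  ()

  >>=-just₂ : ∀ {C : Set} (x : Maybe A) (y : Maybe B) (h : A → B → C) {c : C} →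
              (x >>= λ a → y >>= λ b → just (h a b)) ≡ just c →
              ∃₂ λ a b → x ≡ just a × y ≡ just b × h a b ≡ c
  >>=-just₂ (just a) (just b) h refl = a , b , refl , refl , refl
  >>=-just₂ (just a) nothing  h ()
  >>=-just₂ nothing  y        h ()

module Soundness (a l c : ℕ) where
  open Setup a l c

  variable
    n k          : ℕ
    m m₁ m₂ m' N : CMon
    T U          : HTrc
    v w          : Verdict
    x z          : RVar
    A            : JAct

  data Runs : ℕ → CMon → HTrc → Verdict → Set where
    halt : m ⇛ᶜ v → Runs zero m T v
    step : ∀ {T'} → m ─[ A ]→ᶜ m' → T ─[ A ]→ₜ T' → Runs n m' T' v → Runs (suc n) m T v

  weakBisim-runs : ∀ {R M} → WeakBisim R → R M m → (M ▷ T) ↣* verd v → ∃ λ n → Runs n m T v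
  weakBisim-runs wb RMm (i-act d t ◅ run) with WeakBisim.wb-act wb RMm d
  ... | _ , s , RMm' = Product.map suc (step s t) (weakBisim-runs wb RMm' run)
  weakBisim-runs wb RMm (i-send d ◅ run) = weakBisim-runs wb (WeakBisim.wb-send wb RMm d) run
  weakBisim-runs wb RMm (i-verd e ◅ ε) = zero , halt (Equivalence.to (WeakBisim.wb-verdict wb RMm _) (_ , ε , e))
  weakBisim-runs wb RMm (i-verd e ◅ () ◅ _)

  Runs-resp : (∀ ℓ k → T ℓ k ≡ U ℓ k) → Runs n m T v → Runs n m U v
  Runs-resp T≗U (halt e) = halt e
  Runs-resp T≗U (step s (hd≡ , tl≡) r) =
    step s ((λ ℓ → trans (sym (T≗U ℓ zero)) (hd≡ ℓ)) , (λ ℓ k → trans (sym (T≗U ℓ (suc k))) (tl≡ ℓ k))) r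

  runs-verdict : Runs n (verdᶜ v) T w → v ≡ w
  runs-verdict (halt e-verd) = refl
  runs-verdict (step c-verd _ r) = runs-verdict r

  runs-var : ¬ Runs n (varᶜ x) T w
  runs-var (halt ())
  runs-var (step () _ _)

  runs-rec : Runs n (recᶜ x m) T w → Runs n (unfoldᶜ x m) T w
  runs-rec (halt (e-rec e)) = halt e
  runs-rec (step (c-rec s) t r) = step s t r

  runs-⊗-no : Runs n (m₁ ⊗ᶜ m₂) T no → Runs n m₁ T no ⊎ Runs n m₂ T no
  runs-⊗-no (halt (e-⊗noL e)) = inj₁ (halt e)
  runs-⊗-no (halt (e-⊗noR e)) = inj₂ (halt e)
  runs-⊗-no (halt (e-⊗yesL _ e)) = inj₂ (halt e)
  runs-⊗-no (halt (e-⊗yesR _ e)) = inj₁ (halt e)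
  runs-⊗-no (step (c-⊗ s₁ s₂) t r) = Sum.map (step s₁ t) (step s₂ t) (runs-⊗-no r)

  runs-⊗-yes : Runs n (m₁ ⊗ᶜ m₂) T yes → Runs n m₁ T yes × Runs n m₂ T yes
  runs-⊗-yes (halt (e-⊗yesL e₁ e₂)) = halt e₁ , halt e₂
  runs-⊗-yes (halt (e-⊗yesR e₂ e₁)) = halt e₁ , halt e₂
  runs-⊗-yes (step (c-⊗ s₁ s₂) t r) = Product.map (step s₁ t) (step s₂ t) (runs-⊗-yes r)

  runs-⊕-yes : Runs n (m₁ ⊕ᶜ m₂) T yes → Runs n m₁ T yes ⊎ Runs n m₂ T yes
  runs-⊕-yes (halt (e-⊕yesL e)) = inj₁ (halt e)
  runs-⊕-yes (halt (e-⊕yesR e)) = inj₂ (halt e)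
  runs-⊕-yes (halt (e-⊕noL _ e)) = inj₂ (halt e)
  runs-⊕-yes (halt (e-⊕noR _ e)) = inj₁ (halt e)
  runs-⊕-yes (step (c-⊕ s₁ s₂) t r) = Sum.map (step s₁ t) (step s₂ t) (runs-⊕-yes r)

  runs-⊕-no : Runs n (m₁ ⊕ᶜ m₂) T no → Runs n m₁ T no × Runs n m₂ T no
  runs-⊕-no (halt (e-⊕noL e₁ e₂)) = halt e₁ , halt e₂
  runs-⊕-no (halt (e-⊕noR e₂ e₁)) = halt e₁ , halt e₂
  runs-⊕-no (step (c-⊕ s₁ s₂) t r) = Product.map (step s₁ t) (step s₂ t) (runs-⊕-no r)


  module _ {X : Set} (op : CMon → CMon → CMon) (P : CMon → Set) (f : X → Maybe CMon) where

    bigop-any : (∀ {m₁ m₂} → P (op m₁ m₂) → P m₁ ⊎ P m₂) →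
                ∀ xs → bigop op (List.map f xs) ≡ just m → P m → ∃₂ λ x m' → f x ≡ just m' × P m'
    bigop-any split [] () p
    bigop-any split (x ∷ []) e p = x , _ , e , p
    bigop-any split (x ∷ y ∷ ys) e p =
      let m₁ , _ , e₁ , e₂ , op≡ = >>=-just₂ (f x) (bigop op (List.map f (y ∷ ys))) op e in
      [ (λ p₁ → x , m₁ , e₁ , p₁) , bigop-any split (y ∷ ys) e₂ ]′ (split (subst P (sym op≡) p))

    bigop-all : (∀ {m₁ m₂} → P (op m₁ m₂) → P m₁ × P m₂) →
                ∀ xs → bigop op (List.map f xs) ≡ just m → P m → All (λ x → ∃ λ m' → f x ≡ just m' × P m') xs
    bigop-all split [] () p
    bigop-all split (x ∷ []) e p = (_ , e , p) ∷ []
    bigop-all split (x ∷ y ∷ ys) e p =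
      let m₁ , _ , e₁ , e₂ , op≡ = >>=-just₂ (f x) (bigop op (List.map f (y ∷ ys))) op e
          p₁ , p₂ = split (subst P (sym op≡) p) in
      (m₁ , e₁ , p₁) ∷ bigop-all split (y ∷ ys) e₂ p₂

  Sub : Set
  Sub = RVar → Maybe CMon

  variable
    θ θ' : Sub

  _⟪_↦_⟫ : Sub → RVar → Maybe CMon → Sub
  (θ ⟪ x ↦ o ⟫) y = if does (x ≟ y) then o else θ y

  -- Variables mapped to nothing are left in place. Like substᶜ this is not capture-avoiding,
  -- which is why only closed monitors are ever substituted (ClosedSub).
  psubstᶜ : CMon → Sub → CMon
  psubstᶜ (verdᶜ v) θ = verdᶜ v
  psubstᶜ (b at ℓ ∙ᶜ m) θ = b at ℓ ∙ᶜ psubstᶜ m θ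
  psubstᶜ (m₁ +ᶜ m₂) θ = psubstᶜ m₁ θ +ᶜ psubstᶜ m₂ θ
  psubstᶜ (m₁ ⊕ᶜ m₂) θ = psubstᶜ m₁ θ ⊕ᶜ psubstᶜ m₂ θ
  psubstᶜ (m₁ ⊗ᶜ m₂) θ = psubstᶜ m₁ θ ⊗ᶜ psubstᶜ m₂ θ
  psubstᶜ (recᶜ y m) θ = recᶜ y (psubstᶜ m (θ ⟪ y ↦ nothing ⟫))
  psubstᶜ (varᶜ y) θ = fromMaybe (varᶜ y) (θ y)

  Freeᶜ : RVar → CMon → Set
  Freeᶜ z (verdᶜ v) = ⊥
  Freeᶜ z (b at ℓ ∙ᶜ m) = Freeᶜ z m
  Freeᶜ z (m₁ +ᶜ m₂) = Freeᶜ z m₁ ⊎ Freeᶜ z m₂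
  Freeᶜ z (m₁ ⊕ᶜ m₂) = Freeᶜ z m₁ ⊎ Freeᶜ z m₂
  Freeᶜ z (m₁ ⊗ᶜ m₂) = Freeᶜ z m₁ ⊎ Freeᶜ z m₂
  Freeᶜ z (recᶜ y m) = z ≢ y × Freeᶜ z m
  Freeᶜ z (varᶜ y) = z ≡ y

  Closedᶜ : CMon → Set
  Closedᶜ m = ∀ z → ¬ Freeᶜ z m

  ClosedSub : Sub → Set
  ClosedSub θ = ∀ {y M} → θ y ≡ just M → Closedᶜ M

  ⟪⟫-inv : ∀ θ x o y {M} → (θ ⟪ x ↦ o ⟫) y ≡ just M → (x ≡ y × o ≡ just M) ⊎ (x ≢ y × θ y ≡ just M)
  ⟪⟫-inv θ x o y e with does (x ≟ y) | proof (x ≟ y)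
  ... | true  | ofʸ x≡y = inj₁ (x≡y , e)
  ... | false | ofⁿ x≢y = inj₂ (x≢y , e)

  ⟪⟫-shadow : ∀ {o o'} y → ((θ ⟪ x ↦ o ⟫) ⟪ x ↦ o' ⟫) y ≡ (θ ⟪ x ↦ o' ⟫) y
  ⟪⟫-shadow {x = x} y with does (x ≟ y)
  ... | true  = refl
  ... | false = refl

  ⟪⟫-comm : ∀ {o o'} → x ≢ z → ∀ y → ((θ ⟪ z ↦ o' ⟫) ⟪ x ↦ o ⟫) y ≡ ((θ ⟪ x ↦ o ⟫) ⟪ z ↦ o' ⟫) y
  ⟪⟫-comm {x = x} {z} x≢z y with does (x ≟ y) | proof (x ≟ y) | does (z ≟ y) | proof (z ≟ y)
  ... | true  | ofʸ refl | true  | ofʸ refl = ⊥-elim (x≢z refl)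
  ... | true  | _        | false | _        = refl
  ... | false | _        | true  | _        = refl
  ... | false | _        | false | _        = refl

  ⟪⟫-cong : ∀ {o} → (∀ y → θ y ≡ θ' y) → ∀ y → (θ ⟪ x ↦ o ⟫) y ≡ (θ' ⟪ x ↦ o ⟫) y
  ⟪⟫-cong {x = x} {o} θ≗θ' y = cong (λ o' → if does (x ≟ y) then o else o') (θ≗θ' y)

  ⟪⟫-closed : ∀ {o} → ClosedSub θ → (∀ {M} → o ≡ just M → Closedᶜ M) → ClosedSub (θ ⟪ x ↦ o ⟫)
  ⟪⟫-closed {θ} {x} {o} cl cl-o {y} e with ⟪⟫-inv θ x o y e
  ... | inj₁ (_ , o≡) = cl-o o≡
  ... | inj₂ (_ , θy≡) = cl θy≡

  psubstᶜ-cong : ∀ m → (∀ y → θ y ≡ θ' y) → psubstᶜ m θ ≡ psubstᶜ m θ'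
  psubstᶜ-cong (verdᶜ v) θ≗θ' = refl
  psubstᶜ-cong (b at ℓ ∙ᶜ m) θ≗θ' = cong (b at ℓ ∙ᶜ_) (psubstᶜ-cong m θ≗θ')
  psubstᶜ-cong (m₁ +ᶜ m₂) θ≗θ' = cong₂ _+ᶜ_ (psubstᶜ-cong m₁ θ≗θ') (psubstᶜ-cong m₂ θ≗θ')
  psubstᶜ-cong (m₁ ⊕ᶜ m₂) θ≗θ' = cong₂ _⊕ᶜ_ (psubstᶜ-cong m₁ θ≗θ') (psubstᶜ-cong m₂ θ≗θ')
  psubstᶜ-cong (m₁ ⊗ᶜ m₂) θ≗θ' = cong₂ _⊗ᶜ_ (psubstᶜ-cong m₁ θ≗θ') (psubstᶜ-cong m₂ θ≗θ')
  psubstᶜ-cong (recᶜ y m) θ≗θ' = cong (recᶜ y) (psubstᶜ-cong m (⟪⟫-cong {x = y} θ≗θ'))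
  psubstᶜ-cong (varᶜ y) θ≗θ' = cong (fromMaybe (varᶜ y)) (θ≗θ' y)

  psubstᶜ-empty : ∀ m → psubstᶜ m (λ _ → nothing) ≡ m
  psubstᶜ-empty (verdᶜ v) = refl
  psubstᶜ-empty (b at ℓ ∙ᶜ m) = cong (b at ℓ ∙ᶜ_) (psubstᶜ-empty m)
  psubstᶜ-empty (m₁ +ᶜ m₂) = cong₂ _+ᶜ_ (psubstᶜ-empty m₁) (psubstᶜ-empty m₂)
  psubstᶜ-empty (m₁ ⊕ᶜ m₂) = cong₂ _⊕ᶜ_ (psubstᶜ-empty m₁) (psubstᶜ-empty m₂)
  psubstᶜ-empty (m₁ ⊗ᶜ m₂) = cong₂ _⊗ᶜ_ (psubstᶜ-empty m₁) (psubstᶜ-empty m₂)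
  psubstᶜ-empty (recᶜ y m) =
    cong (recᶜ y) (trans (psubstᶜ-cong m (λ z → if-eta (does (y ≟ z)))) (psubstᶜ-empty m))
  psubstᶜ-empty (varᶜ y) = refl

  substᶜ-fresh : ∀ m → ¬ Freeᶜ x m → substᶜ m x N ≡ m
  substᶜ-fresh (verdᶜ v) x∉ = refl
  substᶜ-fresh (b at ℓ ∙ᶜ m) x∉ = cong (b at ℓ ∙ᶜ_) (substᶜ-fresh m x∉)
  substᶜ-fresh (m₁ +ᶜ m₂) x∉ = cong₂ _+ᶜ_ (substᶜ-fresh m₁ (x∉ ∘ inj₁)) (substᶜ-fresh m₂ (x∉ ∘ inj₂))
  substᶜ-fresh (m₁ ⊕ᶜ m₂) x∉ = cong₂ _⊕ᶜ_ (substᶜ-fresh m₁ (x∉ ∘ inj₁)) (substᶜ-fresh m₂ (x∉ ∘ inj₂))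
  substᶜ-fresh (m₁ ⊗ᶜ m₂) x∉ = cong₂ _⊗ᶜ_ (substᶜ-fresh m₁ (x∉ ∘ inj₁)) (substᶜ-fresh m₂ (x∉ ∘ inj₂))
  substᶜ-fresh {x} (recᶜ y m) x∉ with does (x ≟ y) | proof (x ≟ y)
  ... | true  | _       = refl
  ... | false | ofⁿ x≢y = cong (recᶜ y) (substᶜ-fresh m (x∉ ∘ (x≢y ,_)))
  substᶜ-fresh {x} (varᶜ y) x∉ with does (x ≟ y) | proof (x ≟ y)
  ... | true  | ofʸ x≡y = ⊥-elim (x∉ x≡y)
  ... | false | _       = refl

  psubstᶜ-free : ClosedSub θ → ∀ m → Freeᶜ z (psubstᶜ m θ) → Freeᶜ z m × θ z ≡ nothing
  psubstᶜ-free cl (verdᶜ v) ()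
  psubstᶜ-free cl (b at ℓ ∙ᶜ m) f = psubstᶜ-free cl m f
  psubstᶜ-free cl (m₁ +ᶜ m₂) (inj₁ f) = Product.map₁ inj₁ (psubstᶜ-free cl m₁ f)
  psubstᶜ-free cl (m₁ +ᶜ m₂) (inj₂ f) = Product.map₁ inj₂ (psubstᶜ-free cl m₂ f)
  psubstᶜ-free cl (m₁ ⊕ᶜ m₂) (inj₁ f) = Product.map₁ inj₁ (psubstᶜ-free cl m₁ f)
  psubstᶜ-free cl (m₁ ⊕ᶜ m₂) (inj₂ f) = Product.map₁ inj₂ (psubstᶜ-free cl m₂ f)
  psubstᶜ-free cl (m₁ ⊗ᶜ m₂) (inj₁ f) = Product.map₁ inj₁ (psubstᶜ-free cl m₁ f)
  psubstᶜ-free cl (m₁ ⊗ᶜ m₂) (inj₂ f) = Product.map₁ inj₂ (psubstᶜ-free cl m₂ f)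
  psubstᶜ-free {θ} cl (recᶜ y m) (z≢y , f) with psubstᶜ-free (⟪⟫-closed {θ} {y} cl λ ()) m f
  ... | f' , θ⁻z≡ = (z≢y , f') , trans (sym (if-≟-other (z≢y ∘ sym))) θ⁻z≡
  psubstᶜ-free {θ} {z} cl (varᶜ y) f with θ y in θy
  ... | nothing = f , subst (λ y' → θ y' ≡ nothing) (sym f) θy
  ... | just M = ⊥-elim (cl θy z f)

  substᶜ-psubstᶜ : ClosedSub θ → θ x ≡ nothing → ∀ m →
                   substᶜ (psubstᶜ m θ) x N ≡ psubstᶜ m (θ ⟪ x ↦ just N ⟫)
  substᶜ-psubstᶜ cl θx (verdᶜ v) = refl
  substᶜ-psubstᶜ cl θx (b at ℓ ∙ᶜ m) = cong (b at ℓ ∙ᶜ_) (substᶜ-psubstᶜ cl θx m)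
  substᶜ-psubstᶜ cl θx (m₁ +ᶜ m₂) = cong₂ _+ᶜ_ (substᶜ-psubstᶜ cl θx m₁) (substᶜ-psubstᶜ cl θx m₂)
  substᶜ-psubstᶜ cl θx (m₁ ⊕ᶜ m₂) = cong₂ _⊕ᶜ_ (substᶜ-psubstᶜ cl θx m₁) (substᶜ-psubstᶜ cl θx m₂)
  substᶜ-psubstᶜ cl θx (m₁ ⊗ᶜ m₂) = cong₂ _⊗ᶜ_ (substᶜ-psubstᶜ cl θx m₁) (substᶜ-psubstᶜ cl θx m₂)
  substᶜ-psubstᶜ {θ} {x} {N} cl θx (recᶜ y m) with does (x ≟ y) | proof (x ≟ y)
  ... | true  | ofʸ refl = cong (recᶜ x) (psubstᶜ-cong m (sym ∘ ⟪⟫-shadow {θ = θ} {x = x} {o = just N}))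
  ... | false | ofⁿ x≢y = cong (recᶜ y) (trans
          (substᶜ-psubstᶜ (⟪⟫-closed {θ} {y} cl λ ()) (trans (if-≟-other (x≢y ∘ sym)) θx) m)
          (psubstᶜ-cong m (⟪⟫-comm {x = x} {z = y} {θ = θ} {o = just N} {o' = nothing} x≢y)))
  substᶜ-psubstᶜ {θ} {x} cl θx (varᶜ y) with θ y in θy
  ... | nothing with does (x ≟ y)
  ...   | true  = refl
  ...   | false = refl
  substᶜ-psubstᶜ {θ} {x} cl θx (varᶜ y) | just M with does (x ≟ y) | proof (x ≟ y)
  ...   | true  | ofʸ refl = case trans (sym θx) θy of λ ()
  ...   | false | _        = substᶜ-fresh M (cl θy x)

  sum-any : (P : CMon → Set) → (∀ {m₁ m₂} → P (m₁ +ᶜ m₂) → P m₁ ⊎ P m₂) →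
            ∀ p qs → P (sumᶜ p qs) → P p ⊎ Any P qs
  sum-any P split p [] h = inj₁ h
  sum-any P split p (q ∷ qs) h = Sum.map₂ ([ here , there ]′ ∘ sum-any P split q qs) (split h)

  +-step : (m₁ +ᶜ m₂) ─[ A ]→ᶜ m' → m₁ ─[ A ]→ᶜ m' ⊎ m₂ ─[ A ]→ᶜ m'
  +-step (c-sumL s) = inj₁ s
  +-step (c-sumR s) = inj₂ s

  +-eval : (m₁ +ᶜ m₂) ⇛ᶜ v → m₁ ⇛ᶜ v ⊎ m₂ ⇛ᶜ v
  +-eval (e-sumL e) = inj₁ e
  +-eval (e-sumR e) = inj₂ e

  branches : Loc → Verdict → List Act → List CMon
  branches ℓ v = List.map (λ b → b at ℓ ∙ᶜ verdᶜ v)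

  modalᶜ : Act → Loc → CMon → Verdict → CMon
  modalᶜ b ℓ m v = sumᶜ (b at ℓ ∙ᶜ m) (branches ℓ v (others b))

  others-≢ : ∀ {b b'} → b' ∈ others b → b' ≢ b
  others-≢ {b} = proj₂ ∘ ∈-filter⁻ (λ b' → ¬? (b' Fin.≟ b)) {xs = allFin _}

  ¬Any-branches : ∀ {P : CMon → Set} {ℓ} → (∀ {b} → ¬ P (b at ℓ ∙ᶜ verdᶜ v)) → ∀ bs → ¬ Any P (branches ℓ v bs)
  ¬Any-branches ¬P (b ∷ bs) (here p) = ¬P p
  ¬Any-branches ¬P (b ∷ bs) (there p) = ¬Any-branches ¬P bs p

  branches-step : ∀ {ℓ} bs → Any (_─[ A ]→ᶜ m') (branches ℓ v bs) →
                (A ℓ ∈ bs × m' ≡ verdᶜ v) ⊎ m' ≡ verdᶜ end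
  branches-step (b ∷ bs) (here (c-act p)) = inj₁ (here p , refl)
  branches-step (b ∷ bs) (here (c-actE _)) = inj₂ refl
  branches-step (b ∷ bs) (there s) = Sum.map₁ (Product.map₁ there) (branches-step bs s)

  psubstᶜ-branches : ∀ {ℓ} p bs → psubstᶜ (sumᶜ p (branches ℓ v bs)) θ ≡ sumᶜ (psubstᶜ p θ) (branches ℓ v bs)
  psubstᶜ-branches p [] = refl
  psubstᶜ-branches {θ = θ} p (b ∷ bs) = cong (psubstᶜ p θ +ᶜ_) (psubstᶜ-branches (b at _ ∙ᶜ verdᶜ _) bs)

  modalᶜ-free : ∀ b ℓ m v → Freeᶜ z (modalᶜ b ℓ m v) → Freeᶜ z m
  modalᶜ-free b ℓ m v f =
    [ id , ⊥-elim ∘ ¬Any-branches (λ ()) (others b) ]′ (sum-any (Freeᶜ _) id _ (branches ℓ v (others b)) f)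

  runs-modalᶜ : ∀ {b ℓ} → Runs n (modalᶜ b ℓ m v) T w →
               (∃ λ k → k < n × hd T ℓ ≡ b × Runs k m (tl T) w) ⊎ (hd T ℓ ≢ b × v ≡ w) ⊎ w ≡ end
  runs-modalᶜ {b = b} (halt e) with sum-any (_⇛ᶜ _) +-eval _ (branches _ _ (others b)) e
  ... | inj₁ ()
  ... | inj₂ e' = ⊥-elim (¬Any-branches (λ ()) (others b) e')
  runs-modalᶜ {b = b} {ℓ} (step s t r) with sum-any (_─[ _ ]→ᶜ _) +-step _ (branches _ _ (others b)) s
  ... | inj₁ (c-act A≡b) = inj₁ (_ , n<1+n _ , trans (proj₁ t ℓ) A≡b , Runs-resp (λ ℓ k → sym (proj₂ t ℓ k)) r)
  ... | inj₁ (c-actE _) = inj₂ (inj₂ (sym (runs-verdict r)))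
  ... | inj₂ s' with branches-step (others b) s'
  ...   | inj₁ (A∈ , refl) = inj₂ (inj₁ ((λ hd≡b → others-≢ A∈ (trans (sym (proj₁ t ℓ)) hd≡b)) , runs-verdict r))
  ...   | inj₂ refl = inj₂ (inj₂ (sym (runs-verdict r)))

  runs-psubstᶜ-modalᶜ : ∀ {b ℓ} → Runs n (psubstᶜ (modalᶜ b ℓ m v) θ) T w →
                       (∃ λ k → k < n × hd T ℓ ≡ b × Runs k (psubstᶜ m θ) (tl T) w) ⊎ (hd T ℓ ≢ b × v ≡ w) ⊎ w ≡ end
  runs-psubstᶜ-modalᶜ {b = b} = runs-modalᶜ ∘ subst (λ q → Runs _ q _ _) (psubstᶜ-branches _ (others b))

  testᶜ : ∀ {P : Set} → Dec P → Verdict → Verdict → CMon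
  testᶜ d v w = if does d then verdᶜ v else verdᶜ w

  testᶜ-closed : ∀ {P : Set} (d : Dec P) → Closedᶜ (testᶜ d v w)
  testᶜ-closed (yes′ _) z ()
  testᶜ-closed (no′ _) z ()

  runs-psubstᶜ-testᶜ : ∀ {P : Set} (d : Dec P) {u} → Runs n (psubstᶜ (testᶜ d v w) θ) T u →
                      (P × v ≡ u) ⊎ (¬ P × w ≡ u)
  runs-psubstᶜ-testᶜ (yes′ p) r = inj₁ (p , runs-verdict r)
  runs-psubstᶜ-testᶜ (no′ ¬p) r = inj₂ (¬p , runs-verdict r)

  synth-free : ∀ σ ψ → synth σ ψ ≡ just m → Freeᶜ z m → FreeR z ψ
  synth-free σ tt refl ()
  synth-free σ ff refl ()
  synth-free σ (ψ₁ ∧ᶠ ψ₂) e f with >>=-just₂ (synth σ ψ₁) (synth σ ψ₂) _⊗ᶜ_ e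
  ... | _ , _ , e₁ , e₂ , refl = Sum.map (synth-free σ ψ₁ e₁) (synth-free σ ψ₂ e₂) f
  synth-free σ (ψ₁ ∨ᶠ ψ₂) e f with >>=-just₂ (synth σ ψ₁) (synth σ ψ₂) _⊕ᶜ_ e
  ... | _ , _ , e₁ , e₂ , refl = Sum.map (synth-free σ ψ₁ e₁) (synth-free σ ψ₂ e₂) f
  synth-free σ (maxᶠ x ψ) e f with map-just (recᶜ x) (synth σ ψ) e
  ... | _ , e₀ , refl = Product.map₂ (synth-free σ ψ e₀) f
  synth-free σ (minᶠ x ψ) () f
  synth-free σ (varᶠ x) refl f = f
  synth-free {z = z} σ (∃ᶠ π ψ) e f
    with bigop-any _⊕ᶜ_ (Freeᶜ z) (λ ℓ → synth (σ [ π ↦σ ℓ ]) ψ) id (allFin _) e f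
  ... | ℓ , _ , e' , f' = synth-free (σ [ π ↦σ ℓ ]) ψ e' f'
  synth-free {z = z} σ (∀ᶠ π ψ) e f
    with bigop-any _⊗ᶜ_ (Freeᶜ z) (λ ℓ → synth (σ [ π ↦σ ℓ ]) ψ) id (allFin _) e f
  ... | ℓ , _ , e' , f' = synth-free (σ [ π ↦σ ℓ ]) ψ e' f'
  synth-free σ (π₁ =ᶠ π₂) e f with >>=-just₂ (σ π₁) (σ π₂) (λ ℓ₁ ℓ₂ → testᶜ (ℓ₁ Fin.≟ ℓ₂) yes no) e
  ... | ℓ₁ , ℓ₂ , _ , _ , refl = ⊥-elim (testᶜ-closed (ℓ₁ Fin.≟ ℓ₂) _ f)
  synth-free σ (π₁ ≠ᶠ π₂) e f with >>=-just₂ (σ π₁) (σ π₂) (λ ℓ₁ ℓ₂ → testᶜ (ℓ₁ Fin.≟ ℓ₂) no yes) e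
  ... | ℓ₁ , ℓ₂ , _ , _ , refl = ⊥-elim (testᶜ-closed (ℓ₁ Fin.≟ ℓ₂) _ f)
  synth-free σ ([ b at π ]ᶠ ψ) e f with >>=-just₂ (σ π) (synth σ ψ) (λ ℓ m → modalᶜ b ℓ m yes) e
  ... | ℓ , m₀ , _ , e₀ , refl = synth-free σ ψ e₀ (modalᶜ-free b ℓ m₀ yes f)
  synth-free σ (⟨ b at π ⟩ᶠ ψ) e f with >>=-just₂ (σ π) (synth σ ψ) (λ ℓ m → modalᶜ b ℓ m no) e
  ... | ℓ , m₀ , _ , e₀ , refl = synth-free σ ψ e₀ (modalᶜ-free b ℓ m₀ no f)

  Covers : Form → Sub → Set
  Covers ψ θ = ∀ {z} → FreeR z ψ → θ z ≢ nothing

  AcceptSound : Env → Sub → Set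
  AcceptSound ρ θ = ∀ {x M k T} → θ x ≡ just M → Runs k M T yes → inρ (ρ x) T

  -- Runs of θ x of the full length n are only admitted while x is unguarded in ψ: guardedness
  -- is what lets the induction on the length of the rejecting run go through.
  record RejectSound (n : ℕ) (ψ : Form) (ρ : Env) (θ : Sub) : Set where
    constructor rejecting
    field reject : ∀ {x M k T} → θ x ≡ just M → Runs k M T no → k < n ⊎ (k ≡ n × Unguarded x ψ) → ¬ inρ (ρ x) T
  open RejectSound

  rejectSound-< : ∀ {ψ ψ' ρ} → k < n → RejectSound n ψ ρ θ → RejectSound k ψ' ρ θ
  rejectSound-< k<n rej = rejecting λ where
    θx r (inj₁ j<k) → reject rej θx r (inj₁ (<-trans j<k k<n))
    θx r (inj₂ (refl , _)) → reject rej θx r (inj₁ k<n)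

  rejectSound-⊆ : ∀ {ψ ψ' ρ} → (∀ {x} → Unguarded x ψ' → Unguarded x ψ) →
                  RejectSound n ψ ρ θ → RejectSound n ψ' ρ θ
  rejectSound-⊆ ψ'⊆ψ rej = rejecting λ θx r → reject rej θx r ∘ Sum.map₂ (Product.map₂ ψ'⊆ψ)

  module MaxCase {σ ψ x n₀ θ} (e₀ : synth σ ψ ≡ just n₀) (cl : ClosedSub θ) (cov : Covers (maxᶠ x ψ) θ) where

    θ⁻ : Sub
    θ⁻ = θ ⟪ x ↦ nothing ⟫

    W : CMon
    W = psubstᶜ (recᶜ x n₀) θ

    θ⁺ : Sub
    θ⁺ = θ ⟪ x ↦ just W ⟫

    θ⁻-closed : ClosedSub θ⁻
    θ⁻-closed = ⟪⟫-closed {θ} {x} cl λ ()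

    W-closed : Closedᶜ W
    W-closed z (z≢x , f) with psubstᶜ-free θ⁻-closed n₀ f
    ... | f' , θ⁻z≡ = cov (z≢x , synth-free σ ψ e₀ f') (trans (sym (if-≟-other (z≢x ∘ sym))) θ⁻z≡)

    θ⁺-closed : ClosedSub θ⁺
    θ⁺-closed = ⟪⟫-closed {θ} {x} cl λ { refl → W-closed }

    θ⁺-covers : Covers ψ θ⁺
    θ⁺-covers {z} f with x ≟ z
    ... | yes′ refl = λ θ⁺x → case trans (sym (if-≟-same x)) θ⁺x of λ ()
    ... | no′ x≢z = cov (x≢z ∘ sym , f) ∘ trans (sym (if-≟-other x≢z))

    runs-unfold : Runs k W T v → Runs k (psubstᶜ n₀ θ⁺) T v
    runs-unfold = subst (λ q → Runs _ q _ _) unfold-W ∘ runs-rec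
      where
      open ≡-Reasoning
      unfold-W : unfoldᶜ x (psubstᶜ n₀ θ⁻) ≡ psubstᶜ n₀ θ⁺
      unfold-W = begin
        substᶜ (psubstᶜ n₀ θ⁻) x W          ≡⟨ substᶜ-psubstᶜ θ⁻-closed (if-≟-same x) n₀ ⟩
        psubstᶜ n₀ (θ⁻ ⟪ x ↦ just W ⟫)     ≡⟨ psubstᶜ-cong n₀ (⟪⟫-shadow {θ = θ} {x = x}) ⟩
        psubstᶜ n₀ θ⁺                       ∎

    Accepted : HSet
    Accepted T' = ∃ λ k → Runs k W T' yes

    acceptSound-⁺ : ∀ {ρ} → AcceptSound ρ θ → AcceptSound (ρ [ x ↦ρ Accepted ]) θ⁺
    acceptSound-⁺ acc {y} θ⁺y r with ⟪⟫-inv θ x (just W) y θ⁺y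
    ... | inj₁ (refl , refl) = subst (λ o → inρ o _) (sym (if-≟-same x)) (_ , r)
    ... | inj₂ (x≢y , θy) = subst (λ o → inρ o _) (sym (if-≟-other x≢y)) (acc θy r)

    rejectSound-⁺ : ∀ {ρ S} → ¬ Unguarded x ψ → RejectSound n (maxᶠ x ψ) ρ θ →
                    (∀ {k T'} → k < n → Runs k W T' no → ¬ S T') → RejectSound n ψ (ρ [ x ↦ρ S ]) θ⁺
    rejectSound-⁺ {n} {ρ} {S} x-guarded rej W-rejects = rejecting reject⁺
      where
      reject⁺ : ∀ {y M k T'} → θ⁺ y ≡ just M → Runs k M T' no → k < n ⊎ (k ≡ n × Unguarded y ψ) →
                ¬ inρ ((ρ [ x ↦ρ S ]) y) T'
      reject⁺ {y} θ⁺y r side s with ⟪⟫-inv θ x (just W) y θ⁺y | side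
      ... | inj₁ (refl , refl) | inj₁ k<n = W-rejects k<n r (subst (λ o → inρ o _) (if-≟-same x) s)
      ... | inj₁ (refl , refl) | inj₂ (_ , x-unguarded) = x-guarded x-unguarded
      ... | inj₂ (x≢y , θy) | _ =
        reject rej θy r (Sum.map₂ (Product.map₂ (x≢y ∘ sym ,_)) side) (subst (λ o → inρ o _) (if-≟-other x≢y) s)

  accept-sound : ∀ ψ σ {ρ θ m n T} → ClosedSub θ → Covers ψ θ → AcceptSound ρ θ →
                 synth σ ψ ≡ just m → Runs n (psubstᶜ m θ) T yes → ⟦ ψ ⟧ ρ σ T
  accept-sound tt σ cl cov acc refl r = lift Unit.tt
  accept-sound ff σ cl cov acc refl r with runs-verdict r
  ... | ()
  accept-sound (ψ₁ ∧ᶠ ψ₂) σ cl cov acc e r with >>=-just₂ (synth σ ψ₁) (synth σ ψ₂) _⊗ᶜ_ e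
  ... | _ , _ , e₁ , e₂ , refl =
    Product.map (accept-sound ψ₁ σ cl (cov ∘ inj₁) acc e₁) (accept-sound ψ₂ σ cl (cov ∘ inj₂) acc e₂) (runs-⊗-yes r)
  accept-sound (ψ₁ ∨ᶠ ψ₂) σ cl cov acc e r with >>=-just₂ (synth σ ψ₁) (synth σ ψ₂) _⊕ᶜ_ e
  ... | _ , _ , e₁ , e₂ , refl =
    Sum.map (accept-sound ψ₁ σ cl (cov ∘ inj₁) acc e₁) (accept-sound ψ₂ σ cl (cov ∘ inj₂) acc e₂) (runs-⊕-yes r)
  accept-sound (maxᶠ x ψ) σ {ρ} {n = n} cl cov acc e r with map-just (recᶜ x) (synth σ ψ) e
  ... | _ , e₀ , refl = Accepted , post-fixed , (n , r)
    where
    open MaxCase {σ} {ψ} {x} e₀ cl cov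
    post-fixed : ∀ T' → Accepted T' → ⟦ ψ ⟧ (ρ [ x ↦ρ Accepted ]) σ T'
    post-fixed T' (k , r') = accept-sound ψ σ θ⁺-closed θ⁺-covers (acceptSound-⁺ {ρ} acc) e₀ (runs-unfold r')
  accept-sound (minᶠ x ψ) σ cl cov acc () r
  accept-sound (varᶠ x) σ {θ = θ} cl cov acc refl r with θ x in θx
  ... | nothing = ⊥-elim (runs-var r)
  ... | just M = lift (acc θx r)
  accept-sound (∃ᶠ π ψ) σ {θ = θ} {n = n} {T} cl cov acc e r
    with bigop-any _⊕ᶜ_ (λ q → Runs n (psubstᶜ q θ) T yes) (λ ℓ → synth (σ [ π ↦σ ℓ ]) ψ) runs-⊕-yes (allFin _) e r
  ... | ℓ , _ , e' , r' = ℓ , accept-sound ψ (σ [ π ↦σ ℓ ]) cl cov acc e' r'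
  accept-sound (∀ᶠ π ψ) σ {θ = θ} {n = n} {T} cl cov acc e r ℓ
    with All.lookup (bigop-all _⊗ᶜ_ (λ q → Runs n (psubstᶜ q θ) T yes) _ runs-⊗-yes (allFin _) e r) (∈-allFin ℓ)
  ... | _ , e' , r' = accept-sound ψ (σ [ π ↦σ ℓ ]) cl cov acc e' r'
  accept-sound (π₁ =ᶠ π₂) σ cl cov acc e r with >>=-just₂ (σ π₁) (σ π₂) (λ ℓ₁ ℓ₂ → testᶜ (ℓ₁ Fin.≟ ℓ₂) yes no) e
  ... | ℓ₁ , ℓ₂ , e₁ , e₂ , refl with runs-psubstᶜ-testᶜ (ℓ₁ Fin.≟ ℓ₂) r
  ...   | inj₁ (refl , _) = lift (ℓ₁ , e₁ , e₂)
  ...   | inj₂ (_ , ())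
  accept-sound (π₁ ≠ᶠ π₂) σ cl cov acc e r with >>=-just₂ (σ π₁) (σ π₂) (λ ℓ₁ ℓ₂ → testᶜ (ℓ₁ Fin.≟ ℓ₂) no yes) e
  ... | ℓ₁ , ℓ₂ , e₁ , e₂ , refl with runs-psubstᶜ-testᶜ (ℓ₁ Fin.≟ ℓ₂) r
  ...   | inj₁ (_ , ())
  ...   | inj₂ (ℓ₁≢ℓ₂ , _) = lift (ℓ₁ , ℓ₂ , e₁ , e₂ , ℓ₁≢ℓ₂)
  accept-sound ([ b at π ]ᶠ ψ) σ {ρ} {T = T} cl cov acc e r
    with >>=-just₂ (σ π) (synth σ ψ) (λ ℓ m → modalᶜ b ℓ m yes) e
  ... | ℓ , _ , eπ , e₀ , refl = ℓ , lift eπ , after-b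
    where
    after-b : hd T ℓ ≡ b → ⟦ ψ ⟧ ρ σ (tl T)
    after-b hd≡b with runs-psubstᶜ-modalᶜ r
    ... | inj₁ (_ , _ , _ , r') = accept-sound ψ σ cl cov acc e₀ r'
    ... | inj₂ (inj₁ (hd≢b , _)) = ⊥-elim (hd≢b hd≡b)
    ... | inj₂ (inj₂ ())
  accept-sound (⟨ b at π ⟩ᶠ ψ) σ cl cov acc e r
    with >>=-just₂ (σ π) (synth σ ψ) (λ ℓ m → modalᶜ b ℓ m no) e
  ... | ℓ , _ , eπ , e₀ , refl with runs-psubstᶜ-modalᶜ r
  ...   | inj₁ (_ , _ , hd≡b , r') = ℓ , lift eπ , lift hd≡b , accept-sound ψ σ cl cov acc e₀ r'
  ...   | inj₂ (inj₁ (_ , ()))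
  ...   | inj₂ (inj₂ ())

  RejectSoundAt : ℕ → Set₁
  RejectSoundAt n = ∀ ψ σ {ρ θ m T} → Guarded ψ → ClosedSub θ → Covers ψ θ → RejectSound n ψ ρ θ →
                    synth σ ψ ≡ just m → Runs n (psubstᶜ m θ) T no → ¬ ⟦ ψ ⟧ ρ σ T

  reject-sound-step : ∀ n → (∀ {k} → k < n → RejectSoundAt k) → RejectSoundAt n
  reject-sound-step n ih tt σ g cl cov rej refl r _ with runs-verdict r
  ... | ()
  reject-sound-step n ih ff σ g cl cov rej refl r (lift ())
  reject-sound-step n ih (ψ₁ ∧ᶠ ψ₂) σ (g₁ , g₂) cl cov rej e r (s₁ , s₂)
    with >>=-just₂ (synth σ ψ₁) (synth σ ψ₂) _⊗ᶜ_ e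
  ... | _ , _ , e₁ , e₂ , refl with runs-⊗-no r
  ...   | inj₁ r₁ = reject-sound-step n ih ψ₁ σ g₁ cl (cov ∘ inj₁) (rejectSound-⊆ inj₁ rej) e₁ r₁ s₁
  ...   | inj₂ r₂ = reject-sound-step n ih ψ₂ σ g₂ cl (cov ∘ inj₂) (rejectSound-⊆ inj₂ rej) e₂ r₂ s₂
  reject-sound-step n ih (ψ₁ ∨ᶠ ψ₂) σ (g₁ , g₂) cl cov rej e r s
    with >>=-just₂ (synth σ ψ₁) (synth σ ψ₂) _⊕ᶜ_ e
  ... | _ , _ , e₁ , e₂ , refl with runs-⊕-no r | s
  ...   | r₁ , _ | inj₁ s₁ = reject-sound-step n ih ψ₁ σ g₁ cl (cov ∘ inj₁) (rejectSound-⊆ inj₁ rej) e₁ r₁ s₁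
  ...   | _ , r₂ | inj₂ s₂ = reject-sound-step n ih ψ₂ σ g₂ cl (cov ∘ inj₂) (rejectSound-⊆ inj₂ rej) e₂ r₂ s₂
  reject-sound-step n ih (maxᶠ x ψ) σ (x-guarded , g) cl cov rej e r (S , post-fixed , sT)
    with map-just (recᶜ x) (synth σ ψ) e
  ... | _ , e₀ , refl =
    reject-sound-step n ih ψ σ g θ⁺-closed θ⁺-covers (rejectSound-⁺ x-guarded rej W-rejects) e₀ (runs-unfold r)
      (post-fixed _ sT)
    where
    open MaxCase {σ} {ψ} {x} e₀ cl cov
    W-rejects : ∀ {k T'} → k < n → Runs k W T' no → ¬ S T'
    W-rejects k<n r' s = ih k<n (maxᶠ x ψ) σ (x-guarded , g) cl cov (rejectSound-< k<n rej) e r' (S , post-fixed , s)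
  reject-sound-step n ih (minᶠ x ψ) σ g cl cov rej () r s
  reject-sound-step n ih (varᶠ x) σ {θ = θ} g cl cov rej refl r (lift s) with θ x in θx
  ... | nothing = runs-var r
  ... | just M = reject rej θx r (inj₂ (refl , refl)) s
  reject-sound-step n ih (∃ᶠ π ψ) σ {θ = θ} {T = T} g cl cov rej e r (ℓ , s)
    with All.lookup (bigop-all _⊕ᶜ_ (λ q → Runs n (psubstᶜ q θ) T no) _ runs-⊕-no (allFin _) e r) (∈-allFin ℓ)
  ... | _ , e' , r' = reject-sound-step n ih ψ (σ [ π ↦σ ℓ ]) g cl cov (rejectSound-⊆ id rej) e' r' s
  reject-sound-step n ih (∀ᶠ π ψ) σ {θ = θ} {T = T} g cl cov rej e r s
    with bigop-any _⊗ᶜ_ (λ q → Runs n (psubstᶜ q θ) T no) (λ ℓ → synth (σ [ π ↦σ ℓ ]) ψ) runs-⊗-no (allFin _) e r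
  ... | ℓ , _ , e' , r' = reject-sound-step n ih ψ (σ [ π ↦σ ℓ ]) g cl cov (rejectSound-⊆ id rej) e' r' (s ℓ)
  reject-sound-step n ih (π₁ =ᶠ π₂) σ g cl cov rej e r (lift (ℓ , σπ₁ , σπ₂))
    with >>=-just₂ (σ π₁) (σ π₂) (λ ℓ₁ ℓ₂ → testᶜ (ℓ₁ Fin.≟ ℓ₂) yes no) e
  ... | ℓ₁ , ℓ₂ , e₁ , e₂ , refl with runs-psubstᶜ-testᶜ (ℓ₁ Fin.≟ ℓ₂) r
  ...   | inj₁ (_ , ())
  ...   | inj₂ (ℓ₁≢ℓ₂ , _) = ℓ₁≢ℓ₂ (trans (just-unique e₁ σπ₁) (just-unique σπ₂ e₂))
  reject-sound-step n ih (π₁ ≠ᶠ π₂) σ g cl cov rej e r (lift (k₁ , k₂ , σπ₁ , σπ₂ , k₁≢k₂))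
    with >>=-just₂ (σ π₁) (σ π₂) (λ ℓ₁ ℓ₂ → testᶜ (ℓ₁ Fin.≟ ℓ₂) no yes) e
  ... | ℓ₁ , ℓ₂ , e₁ , e₂ , refl with runs-psubstᶜ-testᶜ (ℓ₁ Fin.≟ ℓ₂) r
  ...   | inj₁ (ℓ₁≡ℓ₂ , _) = k₁≢k₂ (trans (just-unique σπ₁ e₁) (trans ℓ₁≡ℓ₂ (just-unique e₂ σπ₂)))
  ...   | inj₂ (_ , ())
  reject-sound-step n ih ([ b at π ]ᶠ ψ) σ g cl cov rej e r (ℓ' , lift σπ , after-b)
    with >>=-just₂ (σ π) (synth σ ψ) (λ ℓ m → modalᶜ b ℓ m yes) e
  ... | ℓ , _ , eπ , e₀ , refl with just-unique eπ σπ | runs-psubstᶜ-modalᶜ r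
  ...   | refl | inj₁ (_ , k<n , hd≡b , r') = ih k<n ψ σ g cl cov (rejectSound-< k<n rej) e₀ r' (after-b hd≡b)
  ...   | _    | inj₂ (inj₁ (_ , ()))
  ...   | _    | inj₂ (inj₂ ())
  reject-sound-step n ih (⟨ b at π ⟩ᶠ ψ) σ g cl cov rej e r (ℓ' , lift σπ , lift hd≡b , s)
    with >>=-just₂ (σ π) (synth σ ψ) (λ ℓ m → modalᶜ b ℓ m no) e
  ... | ℓ , _ , eπ , e₀ , refl with just-unique eπ σπ | runs-psubstᶜ-modalᶜ r
  ...   | refl | inj₁ (_ , k<n , _ , r') = ih k<n ψ σ g cl cov (rejectSound-< k<n rej) e₀ r' s
  ...   | refl | inj₂ (inj₁ (hd≢b , _)) = hd≢b hd≡b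
  ...   | _    | inj₂ (inj₂ ())

  reject-sound : ∀ n → RejectSoundAt n
  reject-sound = <-rec RejectSoundAt reject-sound-step

  runs-psubstᶜ-empty : Runs n m T v → Runs n (psubstᶜ m (λ _ → nothing)) T v
  runs-psubstᶜ-empty = subst (λ q → Runs _ q _ _) (sym (psubstᶜ-empty _))

  closed-reject-sound : ∀ φ → Guarded φ → (∀ x → ¬ FreeR x φ) →
                        synth ∅σ φ ≡ just m → Runs n m T no → ¬ ⟦ φ ⟧₀ T
  closed-reject-sound φ g closed e r =
    reject-sound _ φ ∅σ g (λ ()) (λ f _ → closed _ f) (rejecting λ ()) e (runs-psubstᶜ-empty r)

  closed-accept-sound : ∀ φ → (∀ x → ¬ FreeR x φ) → synth ∅σ φ ≡ just m → Runs n m T yes → ⟦ φ ⟧₀ T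
  closed-accept-sound φ closed e r =
    accept-sound φ ∅σ (λ ()) (λ f _ → closed _ f) (λ ()) e (runs-psubstᶜ-empty r)

-- MaxHML φ is implied by synth ∅σ φ ≡ just m, and D matters only through the bisimilar pair (M, m).
corollary4p5 : (a l c : ℕ) → let open Setup a l c in
    (D : Assign → Form → Maybe DMon) →
    (T : HTrc) (φ : Form) → WellFormed φ → Closed φ → MaxHML φ →
    (M : DMon) → D ∅σ φ ≡ just M →
    (m : CMon) → synth ∅σ φ ≡ just m →
    (R : DMon → CMon → Set) → WeakBisim R → R M m →
    ((M ▷ T) ↣* verd no → ¬ ⟦ φ ⟧₀ T) × ((M ▷ T) ↣* verd yes → ⟦ φ ⟧₀ T)
corollary4p5 a l c D T φ (guarded , _) (_ , closed) _ M _ m synth≡ R wb RMm =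
  (λ run → closed-reject-sound φ guarded closed synth≡ (proj₂ (weakBisim-runs wb RMm run))) ,
  (λ run → closed-accept-sound φ closed synth≡ (proj₂ (weakBisim-runs wb RMm run)))
  where open Soundness a l c
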